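{- Let $m\ge 3$ be odd and $a$ a positive integer, and suppose the graph $G(a)$ (for $n=4$) has a perfect matching $K$. Then $\mathcal{K}_{m,4}$ has exactly $2^{m-1}(m-1)!$ pairwise Klein bottle nonequivalent $C_4$-face-magic Klein bottle labelings $X$ with $\mathcal{L}(X)=K$.
   Context: $\mathcal{K}_{m,4}$: vertex set $\{(i,j):1\le i\le m,1\le j\le 4\}$, edges $(i,j)(i,j+1)$ ($j\le 3$), $(i,4)(i,1)$, $(i,j)(i+1,j)$ ($i\le m-1$), $(m,j)(1,5-j)$. Its $4$-cycle faces (column indices mod $4$): $\{(i,j),(i,j+1),(i+1,j),(i+1,j+1)\}$, $1\le i\le m-1$, and $\{(m,j),(m,j+1),(1,5-j),(1,4-j)\}$. A $C_4$-face-magic Klein bottle labeling is a bijection $(i,j)\mapsto x_{i,j}$ onto $\{1,\dots,4m\}$ with all face sums equal. Equivalence: with $U(i,j)=(i+1,j)$ ($i<m$), $U(m,j)=(1,5-j)$, $H(i,j)=(i,j+2)$ (mod $4$), $F(i,j)=(i,5-j)$, $KBLS(m,4)=\langle U,H,F\rangle$; labelings $X,X'$ are Klein bottle equivalent if $X'=\{x_{A(i,j)}\}$ for some $A\in KBLS(m,4)$. The graph $G(a)$ has vertex set $\{\{q,4m+1-q\}:1\le q\le 2m\}$, distinct vertices $\{x_1,x_2\},\{y_1,y_2\}$ being adjacent iff $z_1+z_2=a$ for some $z_1\in\{x_1,x_2\}$, $z_2\in\{y_1,y_2\}$. For a $C_4$-face-magic labeling $X$, $\mathcal{L}(X)$ is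 the graph on the same vertex set with edges between $\{x_{2i-1,1},4m+1-x_{2i-1,1}\}$ and $\{x_{2i-1,2},4m+1-x_{2i-1,2}\}$ for $1\le i\le (m+1)/2$, and between $\{x_{2i,4},4m+1-x_{2i,4}\}$ and $\{x_{2i,3},4m+1-x_{2i,3}\}$ for $1\le i\le (m-1)/2$. -}

module Defs where

open import Data.Nat using (ℕ; zero; suc; _+_; _*_; _∸_; _≤_; _<_; _<?_; _^_; _!)
open import Data.Fin using (Fin; zero; suc; toℕ; fromℕ; fromℕ<; inject₁; opposite)
open import Data.Fin.Properties using (toℕ<n)
open import Data.Product using (Σ; ∃; ∃-syntax; _×_; _,_; proj₁; proj₂)
open import Data.Sum using (_⊎_)
open import Data.List using (List; []; _∷_)
open import Relation.Binary.PropositionalEquality using (_≡_; _≢_)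
open import Relation.Nullary using (¬_; yes; no)
open import Function using (id; _∘_)

-- Conventions: rows are 0-based (row r : Fin m stands for i = r+1),
-- columns are 0-based (c : Fin 4 stands for j = c+1).

Vertex : ℕ → Set
Vertex m = Fin m × Fin 4

Labeling : ℕ → Set
Labeling m = Vertex m → ℕ

nextCol : Fin 4 → Fin 4
nextCol zero = suc zero
nextCol (suc zero) = suc (suc zero)
nextCol (suc (suc zero)) = suc (suc (suc zero))
nextCol (suc (suc (suc zero))) = zero

plus2Col : Fin 4 → Fin 4
plus2Col = nextCol ∘ nextCol

-- j ↦ 5-j in 1-based indexing is c ↦ 3-c = opposite c in 0-based indexing

IsBijectiveLabeling : (m : ℕ) → Labeling m → Set
IsBijectiveLabeling m X =
  (∀ v → 1 ≤ X v × X v ≤ 4 * m)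
  × (∀ v w → X v ≡ X w → v ≡ w)
  × (∀ k → 1 ≤ k → k ≤ 4 * m → ∃[ v ] X v ≡ k)

AllFaceSumsEqual : (m : ℕ) → Labeling m → Set
AllFaceSumsEqual m X = ∃[ S ]
  ((∀ (r : Fin m) (lt : suc (toℕ r) < m) (c : Fin 4) →
      X (r , c) + X (r , nextCol c)
        + X (fromℕ< lt , c) + X (fromℕ< lt , nextCol c) ≡ S)
  × (∀ (r₀ rₗ : Fin m) → toℕ r₀ ≡ 0 → suc (toℕ rₗ) ≡ m → (c : Fin 4) →
      X (rₗ , c) + X (rₗ , nextCol c)
        + X (r₀ , opposite c) + X (r₀ , opposite (nextCol c)) ≡ S))

IsFaceMagic : (m : ℕ) → Labeling m → Set
IsFaceMagic m X = IsBijectiveLabeling m X × AllFaceSumsEqual m X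

U : ∀ {m} → Vertex m → Vertex m
U {m} (r , c) with suc (toℕ r) <? m
... | yes lt = (fromℕ< lt , c)
... | no _ = (fromℕ< {0} {m} (Data.Nat.Properties.≤-trans (Data.Nat.s≤s Data.Nat.z≤n) (toℕ<n r)) , opposite c)
  where import Data.Nat.Properties
        import Data.Nat

Uinv : ∀ {m} → Vertex m → Vertex m
Uinv {suc n} (zero , c) = (fromℕ n , opposite c)
Uinv {suc n} (suc r , c) = (inject₁ r , c)

H : ∀ {m} → Vertex m → Vertex m
H (r , c) = (r , plus2Col c)

F : ∀ {m} → Vertex m → Vertex m
F (r , c) = (r , opposite c)

data Gen : Set where
  gU gUinv gH gF : Gen

gen : ∀ {m} → Gen → Vertex m → Vertex m
gen gU = U
gen gUinv = Uinv
gen gH = H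
gen gF = F

-- group elements of KBLS(m,4) = <U,H,F> as words in U, U⁻¹, H, F (H, F are involutions)
act : ∀ {m} → List Gen → Vertex m → Vertex m
act [] = id
act (g ∷ w) = gen g ∘ act w

KBEquivalent : ∀ {m} → Labeling m → Labeling m → Set
KBEquivalent X X' = ∃[ w ] (∀ v → X' v ≡ X (act w v))

-- The vertex {q, 4m+1-q} (1 ≤ q ≤ 2m) is represented by q.
IsGVertex : ℕ → ℕ → Set
IsGVertex m q = 1 ≤ q × q ≤ 2 * m

InV : ℕ → ℕ → ℕ → Set
InV m z q = z ≡ q ⊎ z ≡ (4 * m + 1) ∸ q

GAdj : ℕ → ℕ → ℕ → ℕ → Set
GAdj m a q p = IsGVertex m q × IsGVertex m p × q ≢ p
  × ∃[ z₁ ] ∃[ z₂ ] (InV m z₁ q × InV m z₂ p × z₁ + z₂ ≡ a)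

IsPerfectMatching : ℕ → ℕ → (ℕ → ℕ → Set) → Set
IsPerfectMatching m a K =
  (∀ q p → K q p → GAdj m a q p)
  × (∀ q p → K q p → K p q)
  × (∀ q → IsGVertex m q → ∃[ p ] K q p)
  × (∀ q p p' → K q p → K q p' → p ≡ p')

EdgeVia : ℕ → ℕ → ℕ → ℕ → ℕ → Set
EdgeVia m y₁ y₂ q p = (InV m y₁ q × InV m y₂ p) ⊎ (InV m y₂ q × InV m y₁ p)

-- edge relation of L(X)
-- 1-based row 2i-1 (1 ≤ i ≤ (m+1)/2) is 0-based row 2k with k = i-1, 2k < m;
-- 1-based row 2i   (1 ≤ i ≤ (m-1)/2) is 0-based row 2k+1 with k = i-1, 2k+1 < m.
LEdge : (m : ℕ) → Labeling m → ℕ → ℕ → Set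
LEdge m X q p = IsGVertex m q × IsGVertex m p ×
  ((∃[ k ] Σ (2 * k < m) λ lt →
      EdgeVia m (X (fromℕ< lt , zero)) (X (fromℕ< lt , suc zero)) q p)
  ⊎ (∃[ k ] Σ (suc (2 * k) < m) λ lt →
      EdgeVia m (X (fromℕ< lt , suc (suc (suc zero)))) (X (fromℕ< lt , suc (suc zero))) q p))

SameEdges : (ℕ → ℕ → Set) → (ℕ → ℕ → Set) → Set
SameEdges K L = ∀ q p → (K q p → L q p) × (L q p → K q p)

Good : (m : ℕ) → (ℕ → ℕ → Set) → Labeling m → Set
Good m K X = IsFaceMagic m X × SameEdges (LEdge m X) K

-- exactly N pairwise nonequivalent labelings with property P: a family of N
-- pairwise nonequivalent ones, such that every labeling with P is equivalent to one of them
ExactlyNClasses : (m N : ℕ) → (Labeling m → Set) → Set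
ExactlyNClasses m N P = Σ (Fin N → Labeling m) λ Xs →
  (∀ i → P (Xs i))
  × (∀ i j → i ≢ j → ¬ KBEquivalent (Xs i) (Xs j))
  × (∀ X → P X → ∃[ i ] KBEquivalent (Xs i) X)

-- Put M = 4m + 1. For odd m the face sums along the rows of the Klein bottle force every face sum to be 2M,
-- columns 1, 4 and 2, 3 of each row to hold complementary labels x, M − x, and the sums of columns 1, 2 to
-- alternate between some D and 2M − D from row to row. The rows of L(X) are then the edges of K, and comparing
-- two consecutive rows shows D ∈ {a, 2M − a}; conversely, the row vertices and D determine every label.
-- The symmetry group is abelian and acts simply transitively on the 4m cells, so each class contains exactly
-- one labeling with x_{1,1} = 1; that fixes the first row vertex and D, and the other m − 1 edges of the
-- matching K can then be listed in order, each with a chosen endpoint, in 2^(m−1) (m−1)! ways.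

module Submission where

open import Defs
open import Data.Nat using (ℕ; zero; suc; _+_; _*_; _∸_; _^_; _!; _≤_; _<_; _≤?_; _<?_; _≟_; s≤s; z≤n)
open import Data.Nat.Properties
open import Data.Nat.Tactic.RingSolver using (solve-∀)
open import Data.Bool using (Bool; true; false)
open import Data.Empty using (⊥-elim)
open import Data.Fin using (Fin; zero; suc; toℕ; fromℕ; fromℕ<; inject₁; opposite; cast; remQuot; combine)
open import Data.Fin.Properties
  using (toℕ-fromℕ<; toℕ-fromℕ; toℕ-inject₁; toℕ-injective; toℕ<n; inject₁ℕ<; fromℕ<-toℕ; opposite-involutive;
         cast-involutive; remQuot-combine; combine-remQuot)
import Data.Fin.Properties as Fin
open import Data.Fin.Induction using (<-weakInduction)
open import Data.Fin.Relation.Unary.Top using (view; ‵fromℕ; ‵inject₁)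
open import Data.Product using (∃-syntax; _×_; _,_; proj₁; proj₂; map₂; uncurry)
open import Data.Sum using (_⊎_; inj₁; inj₂)
import Data.Sum as Sum
open import Data.List using (List; []; _∷_; _++_; map; replicate; length; filter; lookup; applyUpTo)
open import Data.List.Properties using (filter-accept; filter-reject; filter-all; length-applyUpTo)
open import Data.List.Membership.Propositional using (_∈_)
open import Data.List.Membership.Propositional.Properties
  using (∈-filter⁺; ∈-filter⁻; ∈-lookup; ∈-applyUpTo⁺; ∈-applyUpTo⁻)
open import Data.List.Relation.Unary.All as All using (All; []; _∷_)
open import Data.List.Relation.Unary.All.Properties using (++⁺; replicate⁺)
open import Data.List.Relation.Unary.AllPairs using ([]; _∷_)
open import Data.List.Relation.Unary.Any using (here; there; index)
open import Data.List.Relation.Unary.Any.Properties using (lookup-index)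
open import Data.List.Relation.Unary.Unique.Propositional using (Unique)
import Data.List.Relation.Unary.Unique.Propositional.Properties as Unique
open import Data.Vec using (Vec; []; _∷_; tabulate) renaming (lookup to lookupᵥ)
open import Data.Vec.Properties using (∷-injectiveˡ; ∷-injectiveʳ; lookup∘tabulate; tabulate∘lookup; tabulate-cong)
open import Function using (id; _∘_)
open import Relation.Binary.PropositionalEquality
open import Relation.Nullary using (¬_; ¬?; Dec; yes; no; contradiction; _×-dec_)
open import Relation.Nullary.Decidable using (_⊎-dec_)

pattern c0 = zero
pattern c1 = suc zero
pattern c2 = suc (suc zero)
pattern c3 = suc (suc (suc zero))

-- The symmetry group KBLS(m,4)

origin : ∀ {n} → Vertex (suc n)
origin = (zero , zero)

ginv : Gen → Gen
ginv gU = gUinv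
ginv gUinv = gU
ginv gH = gH
ginv gF = gF

columnWord : Fin 4 → List Gen
columnWord c0 = []
columnWord c1 = gF ∷ gH ∷ []
columnWord c2 = gH ∷ []
columnWord c3 = gF ∷ []

path : ∀ {n} → Vertex (suc n) → List Gen
path (r , c) = columnWord c ++ replicate (toℕ r) gU

module _ {n : ℕ} where

  U-below : ∀ (r : Fin (suc n)) (lt : suc (toℕ r) < suc n) c → U (r , c) ≡ (fromℕ< lt , c)
  U-below r lt c with suc (toℕ r) <? suc n
  ... | yes _ = refl
  ... | no ¬lt = contradiction lt ¬lt

  U-inject₁ : ∀ (r : Fin n) c → U (inject₁ r , c) ≡ (suc r , c)
  U-inject₁ r c = trans (U-below (inject₁ r) (s≤s (inject₁ℕ< r)) c)
    (cong (_, c) (toℕ-injective (trans (toℕ-fromℕ< (s≤s (inject₁ℕ< r))) (cong suc (toℕ-inject₁ r)))))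

  U-fromℕ : ∀ c → U (fromℕ n , c) ≡ (zero , opposite c)
  U-fromℕ c with suc (toℕ (fromℕ n)) <? suc n
  ... | yes lt = contradiction lt (<-irrefl (cong suc (toℕ-fromℕ n)))
  ... | no _ = refl

  U-map₂ : ∀ (φ : Fin 4 → Fin 4) → (∀ c → opposite (φ c) ≡ φ (opposite c)) →
           U ∘ map₂ φ ≗ map₂ φ ∘ U {suc n}
  U-map₂ φ φ-opp (r , c) with view r
  ... | ‵fromℕ = begin
    U (fromℕ n , φ c)          ≡⟨ U-fromℕ (φ c) ⟩
    (zero , opposite (φ c))    ≡⟨ cong (zero ,_) (φ-opp c) ⟩
    map₂ φ (zero , opposite c) ≡⟨ cong (map₂ φ) (U-fromℕ c) ⟨
    map₂ φ (U (fromℕ n , c))   ∎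
    where open ≡-Reasoning
  ... | ‵inject₁ r′ = trans (U-inject₁ r′ (φ c)) (cong (map₂ φ) (sym (U-inject₁ r′ c)))

  U∘Uinv≗id : U ∘ Uinv ≗ id {A = Vertex (suc n)}
  U∘Uinv≗id (zero , c) = trans (U-fromℕ (opposite c)) (cong (zero ,_) (opposite-involutive c))
  U∘Uinv≗id (suc r , c) = U-inject₁ r c

  Uinv∘U≗id : Uinv ∘ U ≗ id {A = Vertex (suc n)}
  Uinv∘U≗id (r , c) with view r
  ... | ‵fromℕ = trans (cong Uinv (U-fromℕ c)) (cong (fromℕ n ,_) (opposite-involutive c))
  ... | ‵inject₁ r′ = cong Uinv (U-inject₁ r′ c)

  opposite-plus2Col : ∀ c → opposite (plus2Col c) ≡ plus2Col (opposite c)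
  opposite-plus2Col c0 = refl
  opposite-plus2Col c1 = refl
  opposite-plus2Col c2 = refl
  opposite-plus2Col c3 = refl

  U∘gen≗gen∘U : ∀ g → U ∘ gen g ≗ gen g ∘ U {suc n}
  U∘gen≗gen∘U gU v = refl
  U∘gen≗gen∘U gUinv v = trans (U∘Uinv≗id v) (sym (Uinv∘U≗id v))
  U∘gen≗gen∘U gH = U-map₂ plus2Col opposite-plus2Col
  U∘gen≗gen∘U gF = U-map₂ opposite (λ _ → refl)

  Uinv∘gen≗gen∘Uinv : ∀ g → Uinv ∘ gen g ≗ gen g ∘ Uinv {suc n}
  Uinv∘gen≗gen∘Uinv g v = begin
    Uinv (gen g v)              ≡⟨ cong (Uinv ∘ gen g) (U∘Uinv≗id v) ⟨
    Uinv (gen g (U (Uinv v)))   ≡⟨ cong Uinv (U∘gen≗gen∘U g (Uinv v)) ⟨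
    Uinv (U (gen g (Uinv v)))   ≡⟨ Uinv∘U≗id (gen g (Uinv v)) ⟩
    gen g (Uinv v)              ∎
    where open ≡-Reasoning

  H∘F≗F∘H : H ∘ F ≗ F ∘ H {suc n}
  H∘F≗F∘H (r , c) = cong (r ,_) (sym (opposite-plus2Col c))

  gen-comm : ∀ g g′ → gen g ∘ gen g′ ≗ gen g′ ∘ gen {suc n} g
  gen-comm gU g′ = U∘gen≗gen∘U g′
  gen-comm gUinv g′ = Uinv∘gen≗gen∘Uinv g′
  gen-comm g gU = sym ∘ U∘gen≗gen∘U g
  gen-comm g gUinv = sym ∘ Uinv∘gen≗gen∘Uinv g
  gen-comm gH gH v = refl
  gen-comm gH gF = H∘F≗F∘H
  gen-comm gF gH = sym ∘ H∘F≗F∘H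
  gen-comm gF gF v = refl

  act-gen-comm : ∀ w g → act w ∘ gen g ≗ gen g ∘ act {suc n} w
  act-gen-comm [] g v = refl
  act-gen-comm (g′ ∷ w) g v = trans (cong (gen g′) (act-gen-comm w g v)) (gen-comm g′ g (act w v))

  act-comm : ∀ w w′ → act w ∘ act w′ ≗ act w′ ∘ act {suc n} w
  act-comm w [] v = refl
  act-comm w (g ∷ w′) v = trans (act-gen-comm w g (act w′ v)) (cong (gen g) (act-comm w w′ v))

  act-++ : ∀ w w′ → act (w ++ w′) ≗ act w ∘ act {suc n} w′
  act-++ [] w′ v = refl
  act-++ (g ∷ w) w′ v = cong (gen g) (act-++ w w′ v)

  gen∘gen-ginv≗id : ∀ g → gen g ∘ gen (ginv g) ≗ id {A = Vertex (suc n)}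
  gen∘gen-ginv≗id gU = U∘Uinv≗id
  gen∘gen-ginv≗id gUinv = Uinv∘U≗id
  gen∘gen-ginv≗id gH (r , c) = cong (r ,_) (plus2Col-involutive c)
    where
    plus2Col-involutive : ∀ c → plus2Col (plus2Col c) ≡ c
    plus2Col-involutive c0 = refl
    plus2Col-involutive c1 = refl
    plus2Col-involutive c2 = refl
    plus2Col-involutive c3 = refl
  gen∘gen-ginv≗id gF (r , c) = cong (r ,_) (opposite-involutive c)

  act∘act-inverse≗id : ∀ w → act w ∘ act (map ginv w) ≗ id {A = Vertex (suc n)}
  act∘act-inverse≗id [] v = refl
  act∘act-inverse≗id (g ∷ w) v = begin
    gen g (act w (gen (ginv g) (act (map ginv w) v))) ≡⟨ cong (gen g) (act-gen-comm w (ginv g) _) ⟩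
    gen g (gen (ginv g) (act w (act (map ginv w) v))) ≡⟨ cong (gen g ∘ gen (ginv g)) (act∘act-inverse≗id w v) ⟩
    gen g (gen (ginv g) v)                            ≡⟨ gen∘gen-ginv≗id g v ⟩
    v                                                 ∎
    where open ≡-Reasoning

  act-climb : ∀ i (i<1+n : i < suc n) → act (replicate i gU) origin ≡ (fromℕ< i<1+n , zero)
  act-climb zero _ = refl
  act-climb (suc i) 1+i<1+n = begin
    U (act (replicate i gU) origin) ≡⟨ cong U (act-climb i i<1+n) ⟩
    U (fromℕ< i<1+n , zero)         ≡⟨ U-below _ next zero ⟩
    (fromℕ< next , zero)            ≡⟨ cong (_, zero) (toℕ-injective (trans (toℕ-fromℕ< next)
                                         (trans (cong suc (toℕ-fromℕ< i<1+n)) (sym (toℕ-fromℕ< 1+i<1+n))))) ⟩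
    (fromℕ< 1+i<1+n , zero)         ∎
    where
    open ≡-Reasoning
    i<1+n : i < suc n
    i<1+n = <-trans (n<1+n i) 1+i<1+n
    next : suc (toℕ (fromℕ< i<1+n)) < suc n
    next = subst (_< suc n) (cong suc (sym (toℕ-fromℕ< i<1+n))) 1+i<1+n

  act-columnWord : ∀ (r : Fin (suc n)) c → act (columnWord c) (r , zero) ≡ (r , c)
  act-columnWord r c0 = refl
  act-columnWord r c1 = refl
  act-columnWord r c2 = refl
  act-columnWord r c3 = refl

  act-path : ∀ (v : Vertex (suc n)) → act (path v) origin ≡ v
  act-path (r , c) = begin
    act (columnWord c ++ replicate (toℕ r) gU) origin     ≡⟨ act-++ (columnWord c) _ origin ⟩
    act (columnWord c) (act (replicate (toℕ r) gU) origin) ≡⟨ cong (act (columnWord c)) (act-climb _ (toℕ<n r)) ⟩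
    act (columnWord c) (fromℕ< (toℕ<n r) , zero)
      ≡⟨ cong (λ r′ → act (columnWord c) (r′ , zero)) (fromℕ<-toℕ r (toℕ<n r)) ⟩
    act (columnWord c) (r , zero)                          ≡⟨ act-columnWord r c ⟩
    (r , c)                                                ∎
    where open ≡-Reasoning

  path-avoids-Uinv : ∀ (v : Vertex (suc n)) → All (_≢ gUinv) (path v)
  path-avoids-Uinv (r , c) = ++⁺ (columnWord-avoids-Uinv c) (replicate⁺ (toℕ r) (λ ()))
    where
    columnWord-avoids-Uinv : ∀ c → All (_≢ gUinv) (columnWord c)
    columnWord-avoids-Uinv c0 = []
    columnWord-avoids-Uinv c1 = (λ ()) ∷ (λ ()) ∷ []
    columnWord-avoids-Uinv c2 = (λ ()) ∷ []
    columnWord-avoids-Uinv c3 = (λ ()) ∷ []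

  act-fixing-origin : ∀ w → act w origin ≡ origin → act w ≗ id {A = Vertex (suc n)}
  act-fixing-origin w fixed v = begin
    act w v                      ≡⟨ cong (act w) (act-path v) ⟨
    act w (act (path v) origin)  ≡⟨ act-comm w (path v) origin ⟩
    act (path v) (act w origin)  ≡⟨ cong (act (path v)) fixed ⟩
    act (path v) origin          ≡⟨ act-path v ⟩
    v                            ∎
    where open ≡-Reasoning

-- Complementary labels and the vertices of G(a)

+-cancel-by : ∀ {a b c d} → a + c ≡ b + d → c ≡ d → a ≡ b
+-cancel-by {a} {b} {c} a+c≡b+d refl = +-cancelʳ-≡ c a b a+c≡b+d

x+x≡y+y⇒x≡y : ∀ {x y} → x + x ≡ y + y → x ≡ y
x+x≡y+y⇒x≡y {x} {y} eq = *-cancelˡ-≡ x y 2 (trans (double x) (trans eq (sym (double y))))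
  where
  double : ∀ x → 2 * x ≡ x + x
  double = solve-∀

m+n≡o⇒n≡o∸m : ∀ {m n o} → m + n ≡ o → n ≡ o ∸ m
m+n≡o⇒n≡o∸m {m} {n} refl = sym (m+n∸m≡n m n)

module ComplementPairs (m : ℕ) where

  M : ℕ
  M = 4 * m + 1

  private
    M≡2m+[1+2m] : M ≡ 2 * m + suc (2 * m)
    M≡2m+[1+2m] = lemma m
      where
      lemma : ∀ m → 4 * m + 1 ≡ 2 * m + suc (2 * m)
      lemma = solve-∀

    M∸2m≡1+2m : M ∸ 2 * m ≡ suc (2 * m)
    M∸2m≡1+2m = trans (cong (_∸ 2 * m) M≡2m+[1+2m]) (m+n∸m≡n (2 * m) _)

    M∸[1+2m]≡2m : M ∸ suc (2 * m) ≡ 2 * m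
    M∸[1+2m]≡2m = trans (cong (_∸ suc (2 * m)) M≡2m+[1+2m]) (m+n∸n≡m (2 * m) (suc (2 * m)))

    4m<M : 4 * m < M
    4m<M = m<m+n (4 * m) (s≤s z≤n)

  2m<M : 2 * m < M
  2m<M = subst (2 * m <_) (sym M≡2m+[1+2m]) (m<m+n (2 * m) (s≤s z≤n))

  2m≤4m : 2 * m ≤ 4 * m
  2m≤4m = *-monoˡ-≤ m {2} {4} (s≤s (s≤s z≤n))

  vertex≤M : ∀ {q} → IsGVertex m q → q ≤ M
  vertex≤M (_ , q≤2m) = <⇒≤ (≤-<-trans q≤2m 2m<M)

  x+x≢M : ∀ x → x + x ≢ M
  x+x≢M x x+x≡M = even≢odd x (2 * m) (begin
    2 * x       ≡⟨ cong (x +_) (+-identityʳ x) ⟩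
    x + x       ≡⟨ x+x≡M ⟩
    4 * m + 1   ≡⟨ lemma m ⟩
    suc (2 * (2 * m)) ∎)
    where
    open ≡-Reasoning
    lemma : ∀ m → 4 * m + 1 ≡ suc (2 * (2 * m))
    lemma = solve-∀

  x≢M∸x : ∀ {x} → x ≤ M → x ≢ M ∸ x
  x≢M∸x {x} x≤M x≡M∸x = x+x≢M x (trans (cong (x +_) x≡M∸x) (m+[n∸m]≡n x≤M))

  InV-bounds : ∀ {x q} → IsGVertex m q → InV m x q → 1 ≤ x × x ≤ 4 * m
  InV-bounds (1≤q , q≤2m) (inj₁ refl) = 1≤q , ≤-trans q≤2m 2m≤4m
  InV-bounds {q = q} (1≤q , q≤2m) (inj₂ refl) =
    m<n⇒0<n∸m (≤-<-trans q≤2m 2m<M) , ≤-trans (∸-monoʳ-≤ M 1≤q) (≤-reflexive (m+n∸n≡m (4 * m) 1))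

  InV≤M : ∀ {x q} → IsGVertex m q → InV m x q → x ≤ M
  InV≤M q-vtx x∈q = <⇒≤ (≤-<-trans (proj₂ (InV-bounds q-vtx x∈q)) 4m<M)

  InV-compl : ∀ {x q} → IsGVertex m q → InV m x q → InV m (M ∸ x) q
  InV-compl q-vtx (inj₁ refl) = inj₂ refl
  InV-compl q-vtx (inj₂ refl) = inj₁ (m∸[m∸n]≡n (vertex≤M q-vtx))

  InV-cases : ∀ {x y q} → IsGVertex m q → InV m x q → InV m y q → x ≡ y ⊎ x + y ≡ M
  InV-cases q-vtx (inj₁ refl) (inj₁ refl) = inj₁ refl
  InV-cases q-vtx (inj₁ refl) (inj₂ refl) = inj₂ (m+[n∸m]≡n (vertex≤M q-vtx))
  InV-cases q-vtx (inj₂ refl) (inj₁ refl) = inj₂ (m∸n+n≡m (vertex≤M q-vtx))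
  InV-cases q-vtx (inj₂ refl) (inj₂ refl) = inj₁ refl

  InV-pair-cases : ∀ {z x x′ q} → IsGVertex m q → InV m z q → InV m x q → x + x′ ≡ M → z ≡ x ⊎ z ≡ x′
  InV-pair-cases {z} {x} {x′} q-vtx z∈q x∈q x+x′≡M with InV-cases q-vtx z∈q x∈q
  ... | inj₁ z≡x = inj₁ z≡x
  ... | inj₂ z+x≡M = inj₂ (+-cancelʳ-≡ x z x′ (trans z+x≡M (trans (sym x+x′≡M) (+-comm x x′))))

  vertexOf : ℕ → ℕ
  vertexOf x with x ≤? 2 * m
  ... | yes _ = x
  ... | no _ = M ∸ x

  vertexOf-correct : ∀ {x} → 1 ≤ x → x ≤ 4 * m → InV m x (vertexOf x) × IsGVertex m (vertexOf x)
  vertexOf-correct {x} 1≤x x≤4m with x ≤? 2 * m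
  ... | yes x≤2m = inj₁ refl , 1≤x , x≤2m
  ... | no x≰2m = inj₂ (sym (m∸[m∸n]≡n x≤M)) , m<n⇒0<n∸m (≤-<-trans x≤4m 4m<M) ,
                  ≤-trans (∸-monoʳ-≤ M (≰⇒> x≰2m)) (≤-reflexive M∸[1+2m]≡2m)
    where
    x≤M : x ≤ M
    x≤M = ≤-trans x≤4m (<⇒≤ 4m<M)

  vertexOf-unique : ∀ {x q} → IsGVertex m q → InV m x q → vertexOf x ≡ q
  vertexOf-unique {q = q} (_ , q≤2m) (inj₁ refl) with q ≤? 2 * m
  ... | yes _ = refl
  ... | no q≰2m = contradiction q≤2m q≰2m
  vertexOf-unique {q = q} q-vtx@(1≤q , q≤2m) (inj₂ refl) with M ∸ q ≤? 2 * m
  ... | yes M∸q≤2m = contradiction (≤-trans (≤-reflexive (sym M∸2m≡1+2m)) (≤-trans (∸-monoʳ-≤ M q≤2m) M∸q≤2m))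
                                   (<-irrefl refl)
  ... | no _ = m∸[m∸n]≡n (vertex≤M q-vtx)

  module _ {X : Labeling m} (bijective : IsBijectiveLabeling m X) where

    vertexOf-label : ∀ v → InV m (X v) (vertexOf (X v)) × IsGVertex m (vertexOf (X v))
    vertexOf-label v = vertexOf-correct (proj₁ (proj₁ bijective v)) (proj₂ (proj₁ bijective v))

  vertexOf-compl : ∀ {x y} → 1 ≤ x → x ≤ 4 * m → x + y ≡ M → vertexOf y ≡ vertexOf x
  vertexOf-compl {x} {y} 1≤x x≤4m x+y≡M with vertexOf-correct 1≤x x≤4m
  ... | x∈rep , vertex-vtx = vertexOf-unique {y} vertex-vtx
        (subst (λ z → InV m z (vertexOf x)) (sym (m+n≡o⇒n≡o∸m {x} x+y≡M)) (InV-compl vertex-vtx x∈rep))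

-- Face sums along the rows

Row : Set
Row = Fin 4 → ℕ

rowSum : Row → ℕ
rowSum x = x c0 + x c1 + x c2 + x c3

flip : Row → Row
flip x c = x (opposite c)

-- Over ℤ, Adjacent says x c − x (c + 2) = y (c + 2) − y c and Parallel says x c − x (c + 2) = y c − y (c + 2)
-- (for c = 0, 1); the subtractions are moved across to stay in ℕ.
record Adjacent (S : ℕ) (x y : Row) : Set where
  field
    across₀ : x c0 + y c0 ≡ x c2 + y c2
    across₁ : x c1 + y c1 ≡ x c3 + y c3
    sums : rowSum x + rowSum y ≡ S + S

record Parallel (x y : Row) : Set where
  field
    along₀ : x c0 + y c2 ≡ x c2 + y c0
    along₁ : x c1 + y c3 ≡ x c3 + y c1
    sums : rowSum x ≡ rowSum y

open Adjacent
open Parallel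

adjacent : ∀ S (x y : Row) →
  x c0 + x c1 + y c0 + y c1 ≡ S → x c1 + x c2 + y c1 + y c2 ≡ S →
  x c2 + x c3 + y c2 + y c3 ≡ S → x c3 + x c0 + y c3 + y c0 ≡ S → Adjacent S x y
adjacent S x y f₀ f₁ f₂ f₃ = record
  { across₀ = +-cancel-by (shift (x c0) (x c1) (x c2) (y c0) (y c1) (y c2)) (trans f₁ (sym f₀))
  ; across₁ = +-cancel-by (shift (x c1) (x c2) (x c3) (y c1) (y c2) (y c3)) (trans f₂ (sym f₁))
  ; sums = trans (split (x c0) (x c1) (x c2) (x c3) (y c0) (y c1) (y c2) (y c3)) (cong₂ _+_ f₀ f₂) }
  where
  shift : ∀ a b c d e f → (a + d) + (b + c + e + f) ≡ (c + f) + (a + b + d + e)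
  shift = solve-∀
  split : ∀ a b c d e f g h → (a + b + c + d) + (e + f + g + h) ≡ (a + b + e + f) + (c + d + g + h)
  split = solve-∀

Parallel-refl : ∀ x → Parallel x x
Parallel-refl x = record { along₀ = +-comm (x c0) (x c2) ; along₁ = +-comm (x c1) (x c3) ; sums = refl }

Parallel-Adjacent : ∀ {S x y z} → Parallel x y → Adjacent S y z → Adjacent S x z
Parallel-Adjacent {S} {x} {y} {z} p q = record
  { across₀ = +-cancel-by (swap (x c0) (x c2) (y c0) (y c2) (z c0) (z c2)) (cong₂ _+_ (sym (along₀ p)) (sym (across₀ q)))
  ; across₁ = +-cancel-by (swap (x c1) (x c3) (y c1) (y c3) (z c1) (z c3)) (cong₂ _+_ (sym (along₁ p)) (sym (across₁ q)))
  ; sums = trans (cong (_+ rowSum z) (Parallel.sums p)) (Adjacent.sums q) }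
  where
  swap : ∀ x₀ x₂ y₀ y₂ z₀ z₂ → (x₀ + z₀) + ((x₂ + y₀) + (y₂ + z₂)) ≡ (x₂ + z₂) + ((x₀ + y₂) + (y₀ + z₀))
  swap = solve-∀

Adjacent-Adjacent : ∀ {S x y z} → Adjacent S x y → Adjacent S y z → Parallel x z
Adjacent-Adjacent {S} {x} {y} {z} p q = record
  { along₀ = +-cancel-by (swap (x c0) (x c2) (y c0) (y c2) (z c0) (z c2)) (cong₂ _+_ (sym (across₀ p)) (across₀ q))
  ; along₁ = +-cancel-by (swap (x c1) (x c3) (y c1) (y c3) (z c1) (z c3)) (cong₂ _+_ (sym (across₁ p)) (across₁ q))
  ; sums = +-cancelˡ-≡ (rowSum y) _ _ (trans (+-comm (rowSum y) (rowSum x)) (trans (Adjacent.sums p) (sym (Adjacent.sums q)))) }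
  where
  swap : ∀ x₀ x₂ y₀ y₂ z₀ z₂ → (x₀ + z₂) + ((x₂ + y₂) + (y₀ + z₀)) ≡ (x₂ + z₀) + ((x₀ + y₀) + (y₂ + z₂))
  swap = solve-∀

Apart : ℕ → ℕ → Row → Row → Set
Apart S zero = Parallel
Apart S (suc zero) = Adjacent S
Apart S (suc (suc i)) = Apart S i

Apart-step : ∀ {S} i {x y z} → Apart S i x y → Adjacent S y z → Apart S (suc i) x z
Apart-step zero = Parallel-Adjacent
Apart-step (suc zero) = Adjacent-Adjacent
Apart-step (suc (suc i)) = Apart-step i

Apart-even : ∀ {S} k {x y} → Apart S (2 * k) x y → Parallel x y
Apart-even zero p = p
Apart-even {S} (suc k) {x} {y} p = Apart-even k (subst (λ i → Apart S i x y) (*-suc 2 k) p)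

Apart-cases : ∀ {S} i {x y} → Apart S i x y → Parallel x y ⊎ Adjacent S x y
Apart-cases zero p = inj₁ p
Apart-cases (suc zero) p = inj₂ p
Apart-cases (suc (suc i)) p = Apart-cases i p

Balanced : Row → Set
Balanced x = x c0 + x c3 ≡ x c1 + x c2

Balanced-Parallel : ∀ {x z} → Balanced x → Parallel x z → Balanced z
Balanced-Parallel {x} {z} b p = +-cancel-by (rearrange (x c0) (x c1) (x c2) (x c3) (z c0) (z c1) (z c2) (z c3))
  (cong₂ _+_ (cong₂ _+_ (along₀ p) (sym (along₁ p))) (sym b))
  where
  rearrange : ∀ x₀ x₁ x₂ x₃ z₀ z₁ z₂ z₃ →
    (z₀ + z₃) + (((x₀ + z₂) + (x₃ + z₁)) + (x₁ + x₂)) ≡ (z₁ + z₂) + (((x₂ + z₀) + (x₁ + z₃)) + (x₀ + x₃))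
  rearrange = solve-∀

Balanced-Adjacent : ∀ {S x z} → Balanced x → Adjacent S x z → Balanced z
Balanced-Adjacent {S} {x} {z} b p = +-cancel-by (rearrange (x c0) (x c1) (x c2) (x c3) (z c0) (z c1) (z c2) (z c3))
  (cong₂ _+_ (cong₂ _+_ (sym (across₀ p)) (across₁ p)) b)
  where
  rearrange : ∀ x₀ x₁ x₂ x₃ z₀ z₁ z₂ z₃ →
    (z₀ + z₃) + (((x₂ + z₂) + (x₁ + z₁)) + (x₀ + x₃)) ≡ (z₁ + z₂) + (((x₀ + z₀) + (x₃ + z₃)) + (x₁ + x₂))
  rearrange = solve-∀

-- The closing face of the Klein bottle joins the last row to the flipped first row;
-- an odd number of rows makes the first row parallel to the last, hence balanced.
Parallel-Adjacent-flip⇒Balanced : ∀ {S x y} → Parallel x y → Adjacent S y (flip x) → Balanced x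
Parallel-Adjacent-flip⇒Balanced {S} {x} {y} p q = +-cancel-by
  (rearrange (x c0) (x c1) (x c2) (x c3) (y c0) (y c2)) (cong₂ _+_ (sym (along₀ p)) (sym (across₀ q)))
  where
  rearrange : ∀ x₀ x₁ x₂ x₃ y₀ y₂ → (x₀ + x₃) + ((x₂ + y₀) + (y₂ + x₁)) ≡ (x₁ + x₂) + ((x₀ + y₂) + (y₀ + x₃))
  rearrange = solve-∀

Parallel-Adjacent-flip⇒rowSum : ∀ {S x y} → Parallel x y → Adjacent S y (flip x) → rowSum x ≡ S
Parallel-Adjacent-flip⇒rowSum {S} {x} {y} p q = x+x≡y+y⇒x≡y (begin
  rowSum x + rowSum x      ≡⟨ cong₂ _+_ (Parallel.sums p) (reverse (x c0) (x c1) (x c2) (x c3)) ⟩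
  rowSum y + rowSum (flip x) ≡⟨ Adjacent.sums q ⟩
  S + S                    ∎)
  where
  open ≡-Reasoning
  reverse : ∀ a b c d → a + b + c + d ≡ d + c + b + a
  reverse = solve-∀

record FaceSumsEqualTo {n : ℕ} (X : Labeling (suc n)) (S : ℕ) : Set where
  field
    inner : ∀ (r : Fin n) c →
      X (inject₁ r , c) + X (inject₁ r , nextCol c) + X (suc r , c) + X (suc r , nextCol c) ≡ S
    closing : ∀ c →
      X (fromℕ n , c) + X (fromℕ n , nextCol c) + X (zero , opposite c) + X (zero , opposite (nextCol c)) ≡ S

module _ {n : ℕ} where

  fromℕ<-next : ∀ (r : Fin n) (lt : suc (toℕ (inject₁ r)) < suc n) → fromℕ< lt ≡ suc r
  fromℕ<-next r lt = toℕ-injective (trans (toℕ-fromℕ< lt) (cong suc (toℕ-inject₁ r)))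

  faceSumsEqualTo : ∀ {X : Labeling (suc n)} → AllFaceSumsEqual (suc n) X → ∃[ S ] FaceSumsEqualTo X S
  faceSumsEqualTo {X} (S , inner , closing) = S , record
    { inner = λ r c → subst (λ r′ → X (inject₁ r , c) + X (inject₁ r , nextCol c) + X (r′ , c) + X (r′ , nextCol c) ≡ S)
                        (fromℕ<-next r (s≤s (inject₁ℕ< r))) (inner (inject₁ r) (s≤s (inject₁ℕ< r)) c)
    ; closing = closing zero (fromℕ n) refl (cong suc (toℕ-fromℕ n)) }

  allFaceSumsEqual : ∀ {X : Labeling (suc n)} {S} → FaceSumsEqualTo X S → AllFaceSumsEqual (suc n) X
  allFaceSumsEqual {X} {S} faces = S , inner , closing
    where
    open FaceSumsEqualTo faces renaming (inner to inner′; closing to closing′)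
    inner : ∀ (r : Fin (suc n)) (lt : suc (toℕ r) < suc n) c →
      X (r , c) + X (r , nextCol c) + X (fromℕ< lt , c) + X (fromℕ< lt , nextCol c) ≡ S
    inner r lt c with view r
    ... | ‵fromℕ = contradiction lt (<-irrefl (cong suc (toℕ-fromℕ n)))
    ... | ‵inject₁ r′ rewrite fromℕ<-next r′ lt = inner′ r′ c
    closing : ∀ (r₀ rₗ : Fin (suc n)) → toℕ r₀ ≡ 0 → suc (toℕ rₗ) ≡ suc n → ∀ c →
      X (rₗ , c) + X (rₗ , nextCol c) + X (r₀ , opposite c) + X (r₀ , opposite (nextCol c)) ≡ S
    closing r₀ rₗ r₀≡0 rₗ≡n c
      rewrite toℕ-injective {i = r₀} {j = zero} r₀≡0
            | toℕ-injective {i = rₗ} {j = fromℕ n} (trans (suc-injective rₗ≡n) (sym (toℕ-fromℕ n))) = closing′ c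

module FaceAnalysis {k : ℕ} (X : Labeling (suc (2 * k))) {S : ℕ} (faces : FaceSumsEqualTo X S) where

  open FaceSumsEqualTo faces

  row : Fin (suc (2 * k)) → Row
  row r c = X (r , c)

  private
    row₀-Apart : ∀ r → Apart S (toℕ r) (row zero) (row r)
    row₀-Apart = <-weakInduction (λ r → Apart S (toℕ r) (row zero) (row r)) (Parallel-refl (row zero))
      λ r apart → Apart-step (toℕ r) (subst (λ i → Apart S i (row zero) (row (inject₁ r))) (toℕ-inject₁ r) apart)
                    (adjacent S _ _ (inner r c0) (inner r c1) (inner r c2) (inner r c3))

    row₀-Parallel-last : Parallel (row zero) (row (fromℕ (2 * k)))
    row₀-Parallel-last = Apart-even k (subst (λ i → Apart S i (row zero) (row (fromℕ (2 * k))))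
                                             (toℕ-fromℕ (2 * k)) (row₀-Apart (fromℕ (2 * k))))

    last-Adjacent-flip : Adjacent S (row (fromℕ (2 * k))) (flip (row zero))
    last-Adjacent-flip = adjacent S _ _ (closing c0) (closing c1) (closing c2) (closing c3)

    row₀-balanced : Balanced (row zero)
    row₀-balanced = Parallel-Adjacent-flip⇒Balanced row₀-Parallel-last last-Adjacent-flip

    rowSum-row₀ : rowSum (row zero) ≡ S
    rowSum-row₀ = Parallel-Adjacent-flip⇒rowSum row₀-Parallel-last last-Adjacent-flip

  rows-balanced : ∀ r → Balanced (row r) × rowSum (row r) ≡ S
  rows-balanced r with Apart-cases (toℕ r) (row₀-Apart r)
  ... | inj₁ p = Balanced-Parallel row₀-balanced p , trans (sym (Parallel.sums p)) rowSum-row₀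
  ... | inj₂ p = Balanced-Adjacent row₀-balanced p ,
                 +-cancelˡ-≡ S _ _ (trans (cong (_+ rowSum (row r)) (sym rowSum-row₀)) (Adjacent.sums p))

  private
    opposite-sum : ∀ r c → X (r , c) + X (r , opposite c) ≡ X (zero , c0) + X (zero , c3)
    opposite-sum r c = trans (pair-sum r c) (x+x≡y+y⇒x≡y (trans (double r) (sym (double zero))))
      where
      rearrange : ∀ a b c d → (a + d) + (b + c) ≡ a + b + c + d
      rearrange = solve-∀
      double : ∀ r → (X (r , c0) + X (r , c3)) + (X (r , c0) + X (r , c3)) ≡ S
      double r = trans (cong (X (r , c0) + X (r , c3) +_) (proj₁ (rows-balanced r)))
                       (trans (rearrange (X (r , c0)) (X (r , c1)) (X (r , c2)) (X (r , c3))) (proj₂ (rows-balanced r)))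
      pair-sum : ∀ r c → X (r , c) + X (r , opposite c) ≡ X (r , c0) + X (r , c3)
      pair-sum r c0 = refl
      pair-sum r c1 = sym (proj₁ (rows-balanced r))
      pair-sum r c2 = trans (+-comm (X (r , c2)) (X (r , c1))) (sym (proj₁ (rows-balanced r)))
      pair-sum r c3 = +-comm (X (r , c3)) (X (r , c0))

  open ComplementPairs (suc (2 * k))

  module _ (bijective : IsBijectiveLabeling (suc (2 * k)) X) where

    private
      bounds = proj₁ bijective
      onto = proj₂ (proj₂ bijective)
      1≤4m : 1 ≤ 4 * suc (2 * k)
      1≤4m = s≤s z≤n

    opposite-sum≡M : ∀ r c → X (r , c) + X (r , opposite c) ≡ M
    opposite-sum≡M r c with onto 1 ≤-refl 1≤4m | onto (4 * suc (2 * k)) 1≤4m ≤-refl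
    ... | (r₁ , c₁) , X≡1 | (r₂ , c₂) , X≡4m = trans (opposite-sum r c) (≤-antisym
          (subst (_≤ M) (trans (cong (_+ X (r₁ , opposite c₁)) (sym X≡1)) (opposite-sum r₁ c₁))
                 (subst (1 + X (r₁ , opposite c₁) ≤_) (+-comm 1 _) (s≤s (proj₂ (bounds (r₁ , opposite c₁))))))
          (subst (M ≤_) (trans (cong (_+ X (r₂ , opposite c₂)) (sym X≡4m)) (opposite-sum r₂ c₂))
                 (+-monoʳ-≤ _ (proj₁ (bounds (r₂ , opposite c₂))))))

    faceSum≡M+M : S ≡ M + M
    faceSum≡M+M = trans (sym (proj₂ (rows-balanced zero)))
      (trans (rearrange (X (zero , c0)) (X (zero , c1)) (X (zero , c2)) (X (zero , c3)))
             (cong₂ _+_ (opposite-sum≡M zero c0) (opposite-sum≡M zero c1)))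
      where
      rearrange : ∀ a b c d → a + b + c + d ≡ (a + d) + (b + c)
      rearrange = solve-∀

-- Good labelings in arithmetic form

alternate : ℕ → ℕ → ℕ → ℕ
alternate x y zero = x
alternate x y (suc i) = alternate y x i

alternate-swap : ∀ x y i → alternate x y i + alternate y x i ≡ x + y
alternate-swap x y zero = refl
alternate-swap x y (suc i) = trans (+-comm (alternate y x i) _) (alternate-swap x y i)

alternate-even : ∀ x y j → alternate x y (2 * j) ≡ x
alternate-even x y zero = refl
alternate-even x y (suc j) = trans (cong (alternate x y) (*-suc 2 j)) (alternate-even x y j)

alternates : ∀ {n} (d : Fin (suc n) → ℕ) {y} → (∀ (r : Fin n) → d (inject₁ r) + d (suc r) ≡ d zero + y) →
             ∀ r → d r ≡ alternate (d zero) y (toℕ r)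
alternates d {y} consecutive = <-weakInduction (λ r → d r ≡ alternate (d zero) y (toℕ r)) refl step
  where
  step : ∀ r → d (inject₁ r) ≡ alternate (d zero) y (toℕ (inject₁ r)) → d (suc r) ≡ alternate y (d zero) (toℕ r)
  step r d≡ = +-cancelˡ-≡ (d (inject₁ r)) _ _ (begin
    d (inject₁ r) + d (suc r)                                   ≡⟨ consecutive r ⟩
    d zero + y                                                  ≡⟨ alternate-swap (d zero) y (toℕ r) ⟨
    alternate (d zero) y (toℕ r) + alternate y (d zero) (toℕ r) ≡⟨ cong (_+ alternate y (d zero) (toℕ r)) d≡′ ⟨
    d (inject₁ r) + alternate y (d zero) (toℕ r)                ∎)
    where
    open ≡-Reasoning
    d≡′ : d (inject₁ r) ≡ alternate (d zero) y (toℕ r)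
    d≡′ = trans d≡ (cong (alternate (d zero) y) (toℕ-inject₁ r))

even⊎odd : ∀ i → ∃[ j ] (i ≡ 2 * j ⊎ i ≡ suc (2 * j))
even⊎odd zero = 0 , inj₁ refl
even⊎odd (suc i) with even⊎odd i
... | j , inj₁ refl = j , inj₂ refl
... | j , inj₂ refl = suc j , inj₁ (sym (*-suc 2 j))

IsBijectiveLabeling-∘ : ∀ {m} {X : Labeling m} (σ τ : Vertex m → Vertex m) →
  σ ∘ τ ≗ (λ v → v) → τ ∘ σ ≗ (λ v → v) → IsBijectiveLabeling m X → IsBijectiveLabeling m (X ∘ σ)
IsBijectiveLabeling-∘ {X = X} σ τ στ τσ (bounds , injective , onto) =
  (bounds ∘ σ) ,
  (λ v w eq → trans (sym (τσ v)) (trans (cong τ (injective _ _ eq)) (τσ w))) ,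
  (λ i 1≤i i≤4m → let (v , X≡i) = onto i 1≤i i≤4m in τ v , trans (cong X (στ v)) X≡i)

module GoodForms (k : ℕ) where

  open ComplementPairs (suc (2 * k))

  record GoodForm (K : ℕ → ℕ → Set) (X : Labeling (suc (2 * k))) : Set where
    field
      bijective : IsBijectiveLabeling (suc (2 * k)) X
      compl₀₃ : ∀ r → X (r , c0) + X (r , c3) ≡ M
      compl₁₂ : ∀ r → X (r , c1) + X (r , c2) ≡ M
      evenSum oddSum : ℕ
      evenSum+oddSum : evenSum + oddSum ≡ M + M
      pairSum : ∀ r → X (r , c0) + X (r , c1) ≡ alternate evenSum oddSum (toℕ r)
      matched : ∀ r → K (vertexOf (X (r , c0))) (vertexOf (X (r , c1)))

  opposite-pairSum : ∀ {x₀ x₁ x₂ x₃ s t} → x₀ + x₃ ≡ M → x₁ + x₂ ≡ M →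
                     x₀ + x₁ ≡ s → s + t ≡ M + M → x₂ + x₃ ≡ t
  opposite-pairSum {x₀} {x₁} {x₂} {x₃} {s} {t} c₀₃ c₁₂ refl s+t≡2M = +-cancelˡ-≡ (x₀ + x₁) _ _ (begin
    (x₀ + x₁) + (x₂ + x₃) ≡⟨ rearrange x₀ x₁ x₂ x₃ ⟩
    (x₀ + x₃) + (x₁ + x₂) ≡⟨ cong₂ _+_ c₀₃ c₁₂ ⟩
    M + M                 ≡⟨ s+t≡2M ⟨
    (x₀ + x₁) + t         ∎)
    where
    open ≡-Reasoning
    rearrange : ∀ a b c d → (a + b) + (c + d) ≡ (a + d) + (b + c)
    rearrange = solve-∀

  module _ {K : ℕ → ℕ → Set} {X : Labeling (suc (2 * k))} (form : GoodForm K X) where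

    open GoodForm form

    vertexOf-c3 : ∀ r → vertexOf (X (r , c3)) ≡ vertexOf (X (r , c0))
    vertexOf-c3 r = vertexOf-compl (proj₁ (proj₁ bijective (r , c0))) (proj₂ (proj₁ bijective (r , c0))) (compl₀₃ r)

    vertexOf-c2 : ∀ r → vertexOf (X (r , c2)) ≡ vertexOf (X (r , c1))
    vertexOf-c2 r = vertexOf-compl (proj₁ (proj₁ bijective (r , c1))) (proj₂ (proj₁ bijective (r , c1))) (compl₁₂ r)

    vertex-in-row : ∀ {q} → IsGVertex (suc (2 * k)) q → ∃[ r ] (q ≡ vertexOf (X (r , c0)) ⊎ q ≡ vertexOf (X (r , c1)))
    vertex-in-row {q} q-vtx@(1≤q , q≤2m) with proj₂ (proj₂ bijective) q 1≤q (≤-trans q≤2m 2m≤4m)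
    ... | (r , c) , X≡q = r , column c (sym (vertexOf-unique q-vtx (inj₁ X≡q)))
      where
      column : ∀ c → q ≡ vertexOf (X (r , c)) → q ≡ vertexOf (X (r , c0)) ⊎ q ≡ vertexOf (X (r , c1))
      column c0 q≡ = inj₁ q≡
      column c1 q≡ = inj₂ q≡
      column c2 q≡ = inj₂ (trans q≡ (vertexOf-c2 r))
      column c3 q≡ = inj₁ (trans q≡ (vertexOf-c3 r))

    co-pairSum-row : ∀ r → X (r , c2) + X (r , c3) ≡ alternate oddSum evenSum (toℕ r)
    co-pairSum-row r = opposite-pairSum {X (r , c0)} {X (r , c1)} {X (r , c2)} {X (r , c3)} (compl₀₃ r) (compl₁₂ r) (pairSum r)
      (trans (alternate-swap evenSum oddSum (toℕ r)) evenSum+oddSum)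

    pairSum-consecutive : ∀ (r : Fin (2 * k)) →
      (X (inject₁ r , c0) + X (inject₁ r , c1)) + (X (suc r , c0) + X (suc r , c1)) ≡ M + M
    pairSum-consecutive r =
      trans (cong₂ _+_ (trans (pairSum (inject₁ r)) (cong (alternate evenSum oddSum) (toℕ-inject₁ r))) (pairSum (suc r)))
            (trans (alternate-swap evenSum oddSum (toℕ r)) evenSum+oddSum)

  module _ {K : ℕ → ℕ → Set} (K-sym : ∀ q p → K q p → K p q) {X : Labeling (suc (2 * k))} (form : GoodForm K X) where

    open GoodForm form

    GoodForm-∘H : GoodForm K (X ∘ H)
    GoodForm-∘H = record
      { bijective = IsBijectiveLabeling-∘ H H (gen∘gen-ginv≗id gH) (gen∘gen-ginv≗id gH) bijective
      ; compl₀₃ = λ r → trans (+-comm (X (r , c2)) _) (compl₁₂ r)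
      ; compl₁₂ = λ r → trans (+-comm (X (r , c3)) _) (compl₀₃ r)
      ; evenSum+oddSum = trans (+-comm oddSum evenSum) evenSum+oddSum
      ; pairSum = co-pairSum-row form
      ; matched = λ r → subst₂ K (sym (vertexOf-c2 form r)) (sym (vertexOf-c3 form r)) (K-sym _ _ (matched r)) }

    GoodForm-∘F : GoodForm K (X ∘ F)
    GoodForm-∘F = record
      { bijective = IsBijectiveLabeling-∘ F F (gen∘gen-ginv≗id gF) (gen∘gen-ginv≗id gF) bijective
      ; compl₀₃ = λ r → trans (+-comm (X (r , c3)) _) (compl₀₃ r)
      ; compl₁₂ = λ r → trans (+-comm (X (r , c2)) _) (compl₁₂ r)
      ; evenSum+oddSum = trans (+-comm oddSum evenSum) evenSum+oddSum
      ; pairSum = λ r → trans (+-comm (X (r , c3)) _) (co-pairSum-row form r)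
      ; matched = λ r → subst₂ K (sym (vertexOf-c3 form r)) (sym (vertexOf-c2 form r)) (matched r) }

    GoodForm-∘U : GoodForm K (X ∘ U)
    GoodForm-∘U = record
      { bijective = IsBijectiveLabeling-∘ U Uinv U∘Uinv≗id Uinv∘U≗id bijective
      ; compl₀₃ = compl₀₃′
      ; compl₁₂ = compl₁₂′
      ; evenSum+oddSum = trans (+-comm oddSum evenSum) evenSum+oddSum
      ; pairSum = pairSum′
      ; matched = matched′ }
      where
      compl₀₃′ : ∀ r → X (U (r , c0)) + X (U (r , c3)) ≡ M
      compl₀₃′ r with view r
      ... | ‵fromℕ rewrite U-fromℕ {2 * k} c0 | U-fromℕ {2 * k} c3 = trans (+-comm (X (zero , c3)) _) (compl₀₃ zero)
      ... | ‵inject₁ r′ rewrite U-inject₁ r′ c0 | U-inject₁ r′ c3 = compl₀₃ (suc r′)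
      compl₁₂′ : ∀ r → X (U (r , c1)) + X (U (r , c2)) ≡ M
      compl₁₂′ r with view r
      ... | ‵fromℕ rewrite U-fromℕ {2 * k} c1 | U-fromℕ {2 * k} c2 = trans (+-comm (X (zero , c2)) _) (compl₁₂ zero)
      ... | ‵inject₁ r′ rewrite U-inject₁ r′ c1 | U-inject₁ r′ c2 = compl₁₂ (suc r′)
      pairSum′ : ∀ r → X (U (r , c0)) + X (U (r , c1)) ≡ alternate oddSum evenSum (toℕ r)
      pairSum′ r with view r
      ... | ‵fromℕ rewrite U-fromℕ {2 * k} c0 | U-fromℕ {2 * k} c1 | toℕ-fromℕ (2 * k) =
        trans (+-comm (X (zero , c3)) _) (trans (co-pairSum-row form zero) (sym (alternate-even oddSum evenSum k)))
      ... | ‵inject₁ r′ rewrite U-inject₁ r′ c0 | U-inject₁ r′ c1 | toℕ-inject₁ r′ = pairSum (suc r′)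
      matched′ : ∀ r → K (vertexOf (X (U (r , c0)))) (vertexOf (X (U (r , c1))))
      matched′ r with view r
      ... | ‵fromℕ rewrite U-fromℕ {2 * k} c0 | U-fromℕ {2 * k} c1 =
        subst₂ K (sym (vertexOf-c3 form zero)) (sym (vertexOf-c2 form zero)) (matched zero)
      ... | ‵inject₁ r′ rewrite U-inject₁ r′ c0 | U-inject₁ r′ c1 = matched (suc r′)

  GoodForm-∘act : ∀ {K : ℕ → ℕ → Set} → (∀ q p → K q p → K p q) →
    ∀ {X : Labeling (suc (2 * k))} w → All (_≢ gUinv) w → GoodForm K X → GoodForm K (X ∘ act w)
  GoodForm-∘act K-sym [] [] form = form
  GoodForm-∘act K-sym (gU ∷ w) (_ ∷ avoids) form = GoodForm-∘act K-sym w avoids (GoodForm-∘U K-sym form)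
  GoodForm-∘act K-sym (gUinv ∷ w) (≢gUinv ∷ _) form = contradiction refl ≢gUinv
  GoodForm-∘act K-sym (gH ∷ w) (_ ∷ avoids) form = GoodForm-∘act K-sym w avoids (GoodForm-∘H K-sym form)
  GoodForm-∘act K-sym (gF ∷ w) (_ ∷ avoids) form = GoodForm-∘act K-sym w avoids (GoodForm-∘F K-sym form)

module _ (k : ℕ) {K : ℕ → ℕ → Set} where

  open ComplementPairs (suc (2 * k))
  open GoodForms k

  private
    m : ℕ
    m = suc (2 * k)

  -- Odd rows of L(X) read columns 4,3 rather than 1,2; these hold the complements, hence the same vertices of G(a).
  row-LEdge : ∀ {X : Labeling m} → IsBijectiveLabeling m X →
    (∀ r → X (r , c0) + X (r , c3) ≡ M) → (∀ r → X (r , c1) + X (r , c2) ≡ M) →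
    ∀ r → LEdge m X (vertexOf (X (r , c0))) (vertexOf (X (r , c1)))
  row-LEdge {X} bijective compl₀₃ compl₁₂ r = by-parity (even⊎odd (toℕ r))
    where
    q = vertexOf (X (r , c0))
    p = vertexOf (X (r , c1))
    q-vtx = proj₂ (vertexOf-label bijective (r , c0))
    p-vtx = proj₂ (vertexOf-label bijective (r , c1))
    x₀∈q = proj₁ (vertexOf-label bijective (r , c0))
    x₁∈p = proj₁ (vertexOf-label bijective (r , c1))
    x₃∈q : InV m (X (r , c3)) q
    x₃∈q = subst (λ x → InV m x q) (sym (m+n≡o⇒n≡o∸m {X (r , c0)} (compl₀₃ r))) (InV-compl q-vtx x₀∈q)
    x₂∈p : InV m (X (r , c2)) p
    x₂∈p = subst (λ x → InV m x p) (sym (m+n≡o⇒n≡o∸m {X (r , c1)} (compl₁₂ r))) (InV-compl p-vtx x₁∈p)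
    row≡ : ∀ {i} (i<m : i < m) → toℕ r ≡ i → r ≡ fromℕ< i<m
    row≡ i<m refl = sym (toℕ-injective (toℕ-fromℕ< i<m))
    by-parity : ∃[ j ] (toℕ r ≡ 2 * j ⊎ toℕ r ≡ suc (2 * j)) → LEdge m X q p
    by-parity (j , inj₁ r≡2j) = q-vtx , p-vtx , inj₁ (j , 2j<m ,
        subst (λ r′ → EdgeVia m (X (r′ , c0)) (X (r′ , c1)) q p) (row≡ 2j<m r≡2j) (inj₁ (x₀∈q , x₁∈p)))
      where
      2j<m = subst (_< m) r≡2j (toℕ<n r)
    by-parity (j , inj₂ r≡2j+1) = q-vtx , p-vtx , inj₂ (j , 2j+1<m ,
        subst (λ r′ → EdgeVia m (X (r′ , c3)) (X (r′ , c2)) q p) (row≡ 2j+1<m r≡2j+1) (inj₁ (x₃∈q , x₂∈p)))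
      where
      2j+1<m = subst (_< m) r≡2j+1 (toℕ<n r)

  private
    EdgeVia-sym : ∀ {y₁ y₂ q p} → EdgeVia m y₁ y₂ q p → EdgeVia m y₁ y₂ p q
    EdgeVia-sym (inj₁ (y₁∈q , y₂∈p)) = inj₂ (y₂∈p , y₁∈q)
    EdgeVia-sym (inj₂ (y₂∈q , y₁∈p)) = inj₁ (y₁∈p , y₂∈q)

    LEdge-sym : ∀ {X : Labeling m} {q p} → LEdge m X q p → LEdge m X p q
    LEdge-sym (q-vtx , p-vtx , inj₁ (j , lt , via)) = p-vtx , q-vtx , inj₁ (j , lt , EdgeVia-sym via)
    LEdge-sym (q-vtx , p-vtx , inj₂ (j , lt , via)) = p-vtx , q-vtx , inj₂ (j , lt , EdgeVia-sym via)

  module _ {a : ℕ} (matching : IsPerfectMatching m a K) {X : Labeling m} (form : GoodForm K X) where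

    open GoodForm form

    private
      K-adj = proj₁ matching
      K-sym = proj₁ (proj₂ matching)
      K-unique = proj₂ (proj₂ (proj₂ matching))

      LEdge⇒K : ∀ {q p} → LEdge m X q p → K q p
      LEdge⇒K (q-vtx , p-vtx , inj₁ (j , lt , inj₁ (x₀∈q , x₁∈p))) =
        subst₂ K (vertexOf-unique q-vtx x₀∈q) (vertexOf-unique p-vtx x₁∈p) (matched (fromℕ< lt))
      LEdge⇒K (q-vtx , p-vtx , inj₁ (j , lt , inj₂ (x₁∈q , x₀∈p))) =
        subst₂ K (vertexOf-unique q-vtx x₁∈q) (vertexOf-unique p-vtx x₀∈p) (K-sym _ _ (matched (fromℕ< lt)))
      LEdge⇒K (q-vtx , p-vtx , inj₂ (j , lt , inj₁ (x₃∈q , x₂∈p))) =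
        subst₂ K (trans (sym (vertexOf-c3 form (fromℕ< lt))) (vertexOf-unique q-vtx x₃∈q))
                 (trans (sym (vertexOf-c2 form (fromℕ< lt))) (vertexOf-unique p-vtx x₂∈p)) (matched (fromℕ< lt))
      LEdge⇒K (q-vtx , p-vtx , inj₂ (j , lt , inj₂ (x₂∈q , x₃∈p))) =
        subst₂ K (trans (sym (vertexOf-c2 form (fromℕ< lt))) (vertexOf-unique q-vtx x₂∈q))
                 (trans (sym (vertexOf-c3 form (fromℕ< lt))) (vertexOf-unique p-vtx x₃∈p)) (K-sym _ _ (matched (fromℕ< lt)))

      K⇒LEdge : ∀ {q p} → K q p → LEdge m X q p
      K⇒LEdge {q} {p} kqp with vertex-in-row form (proj₁ (K-adj q p kqp))
      ... | r , inj₁ refl = subst (LEdge m X q) (K-unique q _ _ (matched r) kqp)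
                                  (row-LEdge bijective compl₀₃ compl₁₂ r)
      ... | r , inj₂ refl = subst (LEdge m X q) (K-unique q _ _ (K-sym _ _ (matched r)) kqp)
                                  (LEdge-sym {X} (row-LEdge bijective compl₀₃ compl₁₂ r))

      pairSumAt : Fin 4 → ℕ → ℕ
      pairSumAt c0 = alternate evenSum oddSum
      pairSumAt c1 _ = M
      pairSumAt c2 = alternate oddSum evenSum
      pairSumAt c3 _ = M

      pairSumAt-correct : ∀ r c → X (r , c) + X (r , nextCol c) ≡ pairSumAt c (toℕ r)
      pairSumAt-correct r c0 = pairSum r
      pairSumAt-correct r c1 = compl₁₂ r
      pairSumAt-correct r c2 = co-pairSum-row form r
      pairSumAt-correct r c3 = trans (+-comm (X (r , c3)) (X (r , c0))) (compl₀₃ r)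

      pairSumAt-flip : ∀ c → X (zero , opposite c) + X (zero , opposite (nextCol c)) ≡ pairSumAt c 1
      pairSumAt-flip c0 = trans (+-comm (X (zero , c3)) (X (zero , c2))) (co-pairSum-row form zero)
      pairSumAt-flip c1 = trans (+-comm (X (zero , c2)) (X (zero , c1))) (compl₁₂ zero)
      pairSumAt-flip c2 = trans (+-comm (X (zero , c1)) (X (zero , c0))) (pairSum zero)
      pairSumAt-flip c3 = compl₀₃ zero

      pairSumAt-even : ∀ c j → pairSumAt c (2 * j) ≡ pairSumAt c 0
      pairSumAt-even c0 j = alternate-even evenSum oddSum j
      pairSumAt-even c1 j = refl
      pairSumAt-even c2 j = alternate-even oddSum evenSum j
      pairSumAt-even c3 j = refl

      pairSumAt-next : ∀ c i → pairSumAt c i + pairSumAt c (suc i) ≡ M + M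
      pairSumAt-next c0 i = trans (alternate-swap evenSum oddSum i) evenSum+oddSum
      pairSumAt-next c1 i = refl
      pairSumAt-next c2 i = trans (alternate-swap oddSum evenSum i) (trans (+-comm oddSum evenSum) evenSum+oddSum)
      pairSumAt-next c3 i = refl

      two-pairs : ∀ (x y : Row) c {s t} → x c + x (nextCol c) ≡ s → y c + y (nextCol c) ≡ t →
                  x c + x (nextCol c) + y c + y (nextCol c) ≡ s + t
      two-pairs x y c x≡s y≡t = trans (+-assoc (x c + x (nextCol c)) (y c) (y (nextCol c))) (cong₂ _+_ x≡s y≡t)

      row : Fin m → Row
      row r c = X (r , c)

      faceSums : FaceSumsEqualTo X (M + M)
      faceSums = record
        { inner = λ r c → trans
            (two-pairs (row (inject₁ r)) (row (suc r)) c
              (trans (pairSumAt-correct (inject₁ r) c) (cong (pairSumAt c) (toℕ-inject₁ r))) (pairSumAt-correct (suc r) c))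
            (pairSumAt-next c (toℕ r))
        ; closing = λ c → trans
            (two-pairs (row (fromℕ (2 * k))) (flip (row zero)) c
              (trans (pairSumAt-correct (fromℕ (2 * k)) c) (trans (cong (pairSumAt c) (toℕ-fromℕ (2 * k))) (pairSumAt-even c k)))
              (pairSumAt-flip c))
            (pairSumAt-next c 0) }

    GoodForm⇒Good : Good m K X
    GoodForm⇒Good = (bijective , allFaceSumsEqual faceSums) , λ q p → LEdge⇒K , K⇒LEdge

  Good⇒GoodForm : ∀ {X : Labeling m} → Good m K X → GoodForm K X
  Good⇒GoodForm {X} ((bijective , faceSumsEqual) , sameEdges) = record
    { bijective = bijective
    ; compl₀₃ = λ r → opposite-sum≡M bijective r c0
    ; compl₁₂ = λ r → opposite-sum≡M bijective r c1
    ; evenSum+oddSum = E+O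
    ; pairSum = alternates pairSum consecutive
    ; matched = λ r → proj₁ (sameEdges _ _)
                  (row-LEdge bijective (λ r → opposite-sum≡M bijective r c0) (λ r → opposite-sum≡M bijective r c1) r) }
    where
    faces = proj₂ (faceSumsEqualTo faceSumsEqual)
    open FaceAnalysis {k} X faces
    open FaceSumsEqualTo faces
    pairSum co-pairSum : Fin m → ℕ
    pairSum r = X (r , c0) + X (r , c1)
    co-pairSum r = X (r , c2) + X (r , c3)
    E+O : pairSum zero + co-pairSum zero ≡ M + M
    E+O = trans (rearrange (X (zero , c0)) (X (zero , c1)) (X (zero , c2)) (X (zero , c3)))
                (cong₂ _+_ (opposite-sum≡M bijective zero c0) (opposite-sum≡M bijective zero c1))
      where
      rearrange : ∀ a b c d → (a + b) + (c + d) ≡ (a + d) + (b + c)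
      rearrange = solve-∀
    consecutive : ∀ r → pairSum (inject₁ r) + pairSum (suc r) ≡ pairSum zero + co-pairSum zero
    consecutive r = trans (sym (+-assoc (pairSum (inject₁ r)) (X (suc r , c0)) (X (suc r , c1))))
                          (trans (inner r c0) (trans (faceSum≡M+M bijective) (sym E+O)))

-- Ordered listings of a perfect matching, with a chosen endpoint per edge

remove : ℕ → List ℕ → List ℕ
remove q = filter (λ y → ¬? (y ≟ q))

∈-remove⁻ : ∀ {y q ℓ} → y ∈ remove q ℓ → y ∈ ℓ × y ≢ q
∈-remove⁻ = ∈-filter⁻ (λ y → ¬? (y ≟ _))

∈-remove⁺ : ∀ {y q ℓ} → y ∈ ℓ → y ≢ q → y ∈ remove q ℓ
∈-remove⁺ = ∈-filter⁺ (λ y → ¬? (y ≟ _))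

remove-unique : ∀ {q ℓ} → Unique ℓ → Unique (remove q ℓ)
remove-unique = Unique.filter⁺ (λ y → ¬? (y ≟ _))

length-remove : ∀ {q ℓ} → Unique ℓ → q ∈ ℓ → suc (length (remove q ℓ)) ≡ length ℓ
length-remove {q} {y ∷ ℓ} (y∉ℓ ∷ _) (here refl) =
  cong suc (trans (cong length (filter-reject (λ z → ¬? (z ≟ q)) (λ q≢q → q≢q refl)))
                  (cong length (filter-all (λ z → ¬? (z ≟ q)) (All.map (λ q≢z z≡q → q≢z (sym z≡q)) y∉ℓ))))
length-remove {q} {y ∷ ℓ} (y∉ℓ ∷ unique) (there q∈ℓ) =
  trans (cong (suc ∘ length) (filter-accept (λ z → ¬? (z ≟ q)) (All.lookup y∉ℓ q∈ℓ)))
        (cong suc (length-remove unique q∈ℓ))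

lookup-injective : ∀ {ℓ : List ℕ} → Unique ℓ → ∀ {i j} → lookup ℓ i ≡ lookup ℓ j → i ≡ j
lookup-injective {y ∷ ℓ} (y∉ℓ ∷ unique) {zero} {zero} _ = refl
lookup-injective {y ∷ ℓ} (y∉ℓ ∷ unique) {zero} {suc j} y≡ = contradiction y≡ (All.lookup y∉ℓ (∈-lookup j))
lookup-injective {y ∷ ℓ} (y∉ℓ ∷ unique) {suc i} {zero} ≡y = contradiction (sym ≡y) (All.lookup y∉ℓ (∈-lookup i))
lookup-injective {y ∷ ℓ} (y∉ℓ ∷ unique) {suc i} {suc j} eq = cong suc (lookup-injective unique eq)

module Chains {V : ℕ → Set} (π : ℕ → ℕ)
  (π-involutive : ∀ {q} → V q → π (π q) ≡ q) (π-fixpoint-free : ∀ {q} → V q → π q ≢ q) where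

  removePair : ℕ → List ℕ → List ℕ
  removePair q ℓ = remove (π q) (remove q ℓ)

  ∈-removePair⁻ : ∀ {y q ℓ} → y ∈ removePair q ℓ → y ∈ ℓ × y ≢ q × y ≢ π q
  ∈-removePair⁻ y∈ with ∈-remove⁻ y∈
  ... | y∈′ , y≢πq with ∈-remove⁻ y∈′
  ...   | y∈ℓ , y≢q = y∈ℓ , y≢q , y≢πq

  ∈-removePair⁺ : ∀ {y q ℓ} → y ∈ ℓ → y ≢ q → y ≢ π q → y ∈ removePair q ℓ
  ∈-removePair⁺ y∈ℓ y≢q y≢πq = ∈-remove⁺ (∈-remove⁺ y∈ℓ y≢q) y≢πq

  record Pool (k : ℕ) (ℓ : List ℕ) : Set where
    field
      length≡ : length ℓ ≡ 2 * k
      unique : Unique ℓ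
      vertices : ∀ {y} → y ∈ ℓ → V y
      closed : ∀ {y} → y ∈ ℓ → π y ∈ ℓ

  open Pool

  Pool-removePair : ∀ {k ℓ q} → Pool (suc k) ℓ → q ∈ ℓ → Pool k (removePair q ℓ)
  Pool-removePair {k} {ℓ} {q} pool q∈ℓ = record
    { length≡ = suc-injective (suc-injective (begin
        suc (suc (length (removePair q ℓ))) ≡⟨ cong suc (length-remove (remove-unique (unique pool)) πq∈) ⟩
        suc (length (remove q ℓ))            ≡⟨ length-remove (unique pool) q∈ℓ ⟩
        length ℓ                             ≡⟨ length≡ pool ⟩
        2 * suc k                            ≡⟨ *-suc 2 k ⟩
        suc (suc (2 * k))                    ∎))
    ; unique = remove-unique (remove-unique (unique pool))
    ; vertices = vertices pool ∘ proj₁ ∘ ∈-removePair⁻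
    ; closed = λ y∈ → let (y∈ℓ , y≢q , y≢πq) = ∈-removePair⁻ y∈ in
        ∈-removePair⁺ (closed pool y∈ℓ)
          (λ πy≡q → y≢πq (trans (sym (π-involutive (vertices pool y∈ℓ))) (cong π πy≡q)))
          (λ πy≡πq → y≢q (trans (sym (π-involutive (vertices pool y∈ℓ)))
                                (trans (cong π πy≡πq) (π-involutive (vertices pool q∈ℓ))))) }
    where
    open ≡-Reasoning
    πq∈ : π q ∈ remove q ℓ
    πq∈ = ∈-remove⁺ (closed pool q∈ℓ) (π-fixpoint-free (vertices pool q∈ℓ))

  -- qs lists one endpoint of every π-pair of ℓ, each pair once
  Chain : ∀ {k} → List ℕ → Vec ℕ k → Set
  Chain ℓ [] = ℓ ≡ []
  Chain ℓ (q ∷ qs) = q ∈ ℓ × Chain (removePair q ℓ) qs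

  -- the first endpoint is any of the 2(k+1) elements of the pool
  count-step : ∀ k → 2 ^ suc k * suc k ! ≡ (2 * suc k) * (2 ^ k * k !)
  count-step k = lemma (2 ^ k) (k !) k
    where
    lemma : ∀ a b k → (2 * a) * (suc k * b) ≡ (2 * suc k) * (a * b)
    lemma = solve-∀

  split : ∀ k → Fin (2 ^ suc k * suc k !) → Fin (2 * suc k) × Fin (2 ^ k * k !)
  split k i = remQuot (2 ^ k * k !) (cast (count-step k) i)

  split-injective : ∀ k {i i′} → split k i ≡ split k i′ → i ≡ i′
  split-injective k {i} {i′} eq = begin
    i                                                 ≡⟨ cast-involutive (sym (count-step k)) (count-step k) i ⟨
    cast _ (cast (count-step k) i)                    ≡⟨ cong (cast _) (combine-remQuot {2 * suc k} (2 ^ k * k !) _) ⟨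
    cast _ (uncurry combine (split k i))              ≡⟨ cong (cast _ ∘ uncurry combine) eq ⟩
    cast _ (uncurry combine (split k i′))             ≡⟨ cong (cast _) (combine-remQuot {2 * suc k} (2 ^ k * k !) _) ⟩
    cast (sym (count-step k)) (cast (count-step k) i′) ≡⟨ cast-involutive (sym (count-step k)) (count-step k) i′ ⟩
    i′                                                ∎
    where open ≡-Reasoning

  split-surjective : ∀ k j i → split k (cast (sym (count-step k)) (combine j i)) ≡ (j , i)
  split-surjective k j i = trans (cong (remQuot (2 ^ k * k !)) (cast-involutive (count-step k) (sym (count-step k)) _))
                                 (remQuot-combine j i)

  pick : ∀ {k ℓ} → Pool (suc k) ℓ → Fin (2 * suc k) → ℕ
  pick {ℓ = ℓ} pool j = lookup ℓ (cast (sym (length≡ pool)) j)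

  pick-∈ : ∀ {k ℓ} (pool : Pool (suc k) ℓ) j → pick pool j ∈ ℓ
  pick-∈ pool j = ∈-lookup (cast (sym (length≡ pool)) j)

  pick-injective : ∀ {k ℓ} (pool : Pool (suc k) ℓ) {j j′} → pick pool j ≡ pick pool j′ → j ≡ j′
  pick-injective pool {j} {j′} eq = begin
    j                                                        ≡⟨ cast-involutive (length≡ pool) (sym (length≡ pool)) j ⟨
    cast (length≡ pool) (cast (sym (length≡ pool)) j)        ≡⟨ cong (cast (length≡ pool)) (lookup-injective (unique pool) eq) ⟩
    cast (length≡ pool) (cast (sym (length≡ pool)) j′)       ≡⟨ cast-involutive (length≡ pool) (sym (length≡ pool)) j′ ⟩
    j′                                                       ∎
    where open ≡-Reasoning

  decode : ∀ {k ℓ} → Pool k ℓ → Fin (2 ^ k * k !) → Vec ℕ k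
  decode {zero} pool i = []
  decode {suc k} {ℓ} pool i =
    pick pool (proj₁ (split k i)) ∷ decode (Pool-removePair pool (pick-∈ pool (proj₁ (split k i)))) (proj₂ (split k i))

  decode-chain : ∀ {k ℓ} (pool : Pool k ℓ) i → Chain ℓ (decode pool i)
  decode-chain {zero} {[]} pool i = refl
  decode-chain {suc k} pool i = pick-∈ pool (proj₁ (split k i)) , decode-chain _ (proj₂ (split k i))

  private
    decode-cons-injective : ∀ {k ℓ} (pool : Pool (suc k) ℓ) →
      (∀ {ℓ′} (pool′ : Pool k ℓ′) {i i′} → decode pool′ i ≡ decode pool′ i′ → i ≡ i′) →
      ∀ (s s′ : Fin (2 * suc k) × Fin (2 ^ k * k !)) →
      pick pool (proj₁ s) ∷ decode (Pool-removePair pool (pick-∈ pool (proj₁ s))) (proj₂ s) ≡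
      pick pool (proj₁ s′) ∷ decode (Pool-removePair pool (pick-∈ pool (proj₁ s′))) (proj₂ s′) → s ≡ s′
    decode-cons-injective pool tail-injective (j , i) (j′ , i′) eq with pick-injective pool {j} {j′} (∷-injectiveˡ eq)
    ... | refl = cong (j ,_) (tail-injective _ (∷-injectiveʳ eq))

  decode-injective : ∀ {k ℓ} (pool : Pool k ℓ) {i i′} → decode pool i ≡ decode pool i′ → i ≡ i′
  decode-injective {zero} pool {zero} {zero} _ = refl
  decode-injective {suc k} pool {i} {i′} eq =
    split-injective k (decode-cons-injective pool decode-injective (split k i) (split k i′) eq)

  decode-complete : ∀ {k ℓ} (pool : Pool k ℓ) qs → Chain ℓ qs → ∃[ i ] decode pool i ≡ qs
  decode-complete {zero} pool [] _ = zero , refl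
  decode-complete {suc k} {ℓ} pool (q ∷ qs) (q∈ℓ , chain) =
    cast (sym (count-step k)) (combine j (proj₁ rest)) ,
    trans (cong (λ s → pick pool (proj₁ s) ∷ decode (Pool-removePair pool (pick-∈ pool (proj₁ s))) (proj₂ s))
                (split-surjective k j (proj₁ rest)))
          (cong₂ _∷_ pick≡q (proj₂ rest))
    where
    j : Fin (2 * suc k)
    j = cast (length≡ pool) (index q∈ℓ)
    pick≡q : pick pool j ≡ q
    pick≡q = trans (cong (lookup ℓ) (cast-involutive (sym (length≡ pool)) (length≡ pool) (index q∈ℓ)))
                   (sym (lookup-index q∈ℓ))
    rest : ∃[ i ] decode (Pool-removePair pool (pick-∈ pool j)) i ≡ qs
    rest = decode-complete _ qs (subst (λ p → Chain (removePair p ℓ) qs) (sym pick≡q) chain)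

  record Enumerates {n} (ℓ : List ℕ) (u : Vec ℕ n) : Set where
    field
      members : ∀ r → lookupᵥ u r ∈ ℓ
      separated : ∀ r r′ → lookupᵥ u r ≡ lookupᵥ u r′ ⊎ lookupᵥ u r ≡ π (lookupᵥ u r′) → r ≡ r′
      covers : ∀ {y} → y ∈ ℓ → ∃[ r ] (y ≡ lookupᵥ u r ⊎ y ≡ π (lookupᵥ u r))

  open Enumerates

  chain⇒enumerates : ∀ {n ℓ} {u : Vec ℕ n} → (∀ {y} → y ∈ ℓ → V y) → Chain ℓ u → Enumerates ℓ u
  chain⇒enumerates {u = []} _ refl = record { members = λ () ; separated = λ () ; covers = λ () }
  chain⇒enumerates {ℓ = ℓ} {u = q ∷ qs} in-V (q∈ℓ , chain) = record
    { members = members′ ; separated = separated′ ; covers = covers′ }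
    where
    rest : Enumerates (removePair q ℓ) qs
    rest = chain⇒enumerates (in-V ∘ proj₁ ∘ ∈-removePair⁻) chain
    apart : ∀ r → lookupᵥ qs r ≢ q × lookupᵥ qs r ≢ π q
    apart r = proj₂ (∈-removePair⁻ {ℓ = ℓ} (members rest r))
    members′ : ∀ r → lookupᵥ (q ∷ qs) r ∈ ℓ
    members′ zero = q∈ℓ
    members′ (suc r) = proj₁ (∈-removePair⁻ {ℓ = ℓ} (members rest r))
    separated′ : ∀ r r′ → lookupᵥ (q ∷ qs) r ≡ lookupᵥ (q ∷ qs) r′ ⊎ lookupᵥ (q ∷ qs) r ≡ π (lookupᵥ (q ∷ qs) r′) →
                 r ≡ r′
    separated′ zero zero _ = refl
    separated′ zero (suc r′) (inj₁ q≡) = contradiction (sym q≡) (proj₁ (apart r′))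
    separated′ zero (suc r′) (inj₂ q≡π) = contradiction
      (trans (sym (π-involutive (in-V (members′ (suc r′))))) (cong π (sym q≡π))) (proj₂ (apart r′))
    separated′ (suc r) zero (inj₁ ≡q) = contradiction ≡q (proj₁ (apart r))
    separated′ (suc r) zero (inj₂ ≡πq) = contradiction ≡πq (proj₂ (apart r))
    separated′ (suc r) (suc r′) eq = cong suc (separated rest r r′ eq)
    covers′ : ∀ {y} → y ∈ ℓ → ∃[ r ] (y ≡ lookupᵥ (q ∷ qs) r ⊎ y ≡ π (lookupᵥ (q ∷ qs) r))
    covers′ {y} y∈ℓ with y ≟ q | y ≟ π q
    ... | yes y≡q | _ = zero , inj₁ y≡q
    ... | no _ | yes y≡πq = zero , inj₂ y≡πq
    ... | no y≢q | no y≢πq with covers rest (∈-removePair⁺ y∈ℓ y≢q y≢πq)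
    ...   | r , y≡ = suc r , y≡

  Enumerates-tail : ∀ {n ℓ q} {qs : Vec ℕ n} → Enumerates ℓ (q ∷ qs) → Enumerates (removePair q ℓ) qs
  Enumerates-tail {ℓ = ℓ} {q} {qs} enum = record
    { members = λ r → ∈-removePair⁺ (members enum (suc r))
                        (λ ≡q → suc≢zero (separated enum (suc r) zero (inj₁ ≡q)))
                        (λ ≡πq → suc≢zero (separated enum (suc r) zero (inj₂ ≡πq)))
    ; separated = λ r r′ eq → Fin.suc-injective (separated enum (suc r) (suc r′) eq)
    ; covers = covers′ }
    where
    suc≢zero : ∀ {n} {r : Fin n} → suc r ≢ zero
    suc≢zero ()
    drop-first : ∀ {y} → y ≢ q → y ≢ π q → ∃[ r ] (y ≡ lookupᵥ (q ∷ qs) r ⊎ y ≡ π (lookupᵥ (q ∷ qs) r)) →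
                 ∃[ r ] (y ≡ lookupᵥ qs r ⊎ y ≡ π (lookupᵥ qs r))
    drop-first y≢q y≢πq (zero , inj₁ y≡q) = contradiction y≡q y≢q
    drop-first y≢q y≢πq (zero , inj₂ y≡πq) = contradiction y≡πq y≢πq
    drop-first y≢q y≢πq (suc r , y≡) = r , y≡
    covers′ : ∀ {y} → y ∈ removePair q ℓ → ∃[ r ] (y ≡ lookupᵥ qs r ⊎ y ≡ π (lookupᵥ qs r))
    covers′ y∈ = let (y∈ℓ , y≢q , y≢πq) = ∈-removePair⁻ y∈ in drop-first y≢q y≢πq (covers enum y∈ℓ)

  enumerates⇒chain : ∀ {n} (u : Vec ℕ n) {ℓ} → Enumerates ℓ u → Chain ℓ u
  enumerates⇒chain [] {ℓ} enum = nothing-to-cover ℓ (covers enum)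
    where
    nothing-to-cover : ∀ ℓ → (∀ {y} → y ∈ ℓ → ∃[ r ] (y ≡ lookupᵥ [] r ⊎ y ≡ π (lookupᵥ [] r))) → ℓ ≡ []
    nothing-to-cover [] _ = refl
    nothing-to-cover (y ∷ ℓ) covered = ⊥-elim (Fin.¬Fin0 (proj₁ (covered {y} (here refl))))
  enumerates⇒chain (q ∷ qs) {ℓ} enum =
    members enum zero , enumerates⇒chain qs {removePair q ℓ} (Enumerates-tail {ℓ = ℓ} {q} {qs} enum)

-- The labeling of a listing

module Partners (m a : ℕ) {K : ℕ → ℕ → Set} (matching : IsPerfectMatching m a K) where

  private
    K-adj = proj₁ matching
    K-sym = proj₁ (proj₂ matching)
    K-total = proj₁ (proj₂ (proj₂ matching))
    K-unique = proj₂ (proj₂ (proj₂ matching))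

  isGVertex? : ∀ q → Dec (IsGVertex m q)
  isGVertex? q = (1 ≤? q) ×-dec (q ≤? 2 * m)

  -- the junk value 0 outside the vertex set is never used
  partner : ℕ → ℕ
  partner q with isGVertex? q
  ... | yes q-vtx = proj₁ (K-total q q-vtx)
  ... | no _ = 0

  K-partner : ∀ {q} → IsGVertex m q → K q (partner q)
  K-partner {q} q-vtx with isGVertex? q
  ... | yes q-vtx′ = proj₂ (K-total q q-vtx′)
  ... | no ¬q-vtx = contradiction q-vtx ¬q-vtx

  partner-unique : ∀ {q p} → K q p → p ≡ partner q
  partner-unique {q} {p} kqp = K-unique q p (partner q) kqp (K-partner (proj₁ (K-adj q p kqp)))

  partner-vertex : ∀ {q} → IsGVertex m q → IsGVertex m (partner q)
  partner-vertex q-vtx = proj₁ (proj₂ (K-adj _ _ (K-partner q-vtx)))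

  partner-involutive : ∀ {q} → IsGVertex m q → partner (partner q) ≡ q
  partner-involutive q-vtx = sym (partner-unique (K-sym _ _ (K-partner q-vtx)))

  partner-fixpoint-free : ∀ {q} → IsGVertex m q → partner q ≢ q
  partner-fixpoint-free q-vtx eq = proj₁ (proj₂ (proj₂ (K-adj _ _ (K-partner q-vtx)))) (sym eq)

  open Chains partner partner-involutive partner-fixpoint-free public

  vertices : List ℕ
  vertices = applyUpTo suc (2 * m)

  ∈-vertices⁺ : ∀ {q} → IsGVertex m q → q ∈ vertices
  ∈-vertices⁺ {suc q} (_ , q<2m) = ∈-applyUpTo⁺ suc q<2m

  ∈-vertices⁻ : ∀ {q} → q ∈ vertices → IsGVertex m q
  ∈-vertices⁻ q∈ with ∈-applyUpTo⁻ suc q∈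
  ... | i , i<2m , refl = s≤s z≤n , i<2m

  vertices-pool : Pool m vertices
  vertices-pool = record
    { length≡ = length-applyUpTo suc (2 * m)
    ; unique = Unique.applyUpTo⁺₁ suc (2 * m) (λ i<j _ → <⇒≢ (s≤s i<j))
    ; vertices = ∈-vertices⁻
    ; closed = ∈-vertices⁺ ∘ partner-vertex ∘ ∈-vertices⁻ }

module Splitting (m a : ℕ) {K : ℕ → ℕ → Set} (matching : IsPerfectMatching m a K) where

  open ComplementPairs m
  open Partners m a matching

  private
    K-adj = proj₁ matching

  Splits : ℕ → ℕ → ℕ → Set
  Splits q t x = InV m x q × x ≤ t × InV m (t ∸ x) (partner q)

  splits? : ∀ q t x → Dec (Splits q t x)
  splits? q t x = InV? x q ×-dec (x ≤? t) ×-dec InV? (t ∸ x) (partner q)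
    where
    InV? : ∀ x q → Dec (InV m x q)
    InV? x q = (x ≟ q) ⊎-dec (x ≟ M ∸ q)

  solve : ℕ → ℕ → ℕ
  solve q t with splits? q t q
  ... | yes _ = q
  ... | no _ = M ∸ q

  solve-correct : ∀ {q t x} → Splits q t x → Splits q t (solve q t)
  solve-correct {q} {t} x-splits with splits? q t q
  ... | yes q-splits = q-splits
  ... | no ¬q-splits with proj₁ x-splits
  ...   | inj₁ refl = contradiction x-splits ¬q-splits
  ...   | inj₂ refl = x-splits

  splits-unique : ∀ {q t x y} → IsGVertex m q → t ≢ M → Splits q t x → Splits q t y → x ≡ y
  splits-unique {q} {t} {x} {y} q-vtx t≢M (x∈q , x≤t , t∸x∈) (y∈q , y≤t , t∸y∈)
    with InV-cases q-vtx x∈q y∈q | InV-cases (partner-vertex q-vtx) t∸x∈ t∸y∈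
  ... | inj₁ x≡y | _ = x≡y
  ... | inj₂ _ | inj₁ t∸x≡t∸y = ∸-cancelˡ-≡ x≤t y≤t t∸x≡t∸y
  ... | inj₂ x+y≡M | inj₂ t∸x+t∸y≡M = contradiction (x+x≡y+y⇒x≡y (begin
    t + t                         ≡⟨ cong₂ _+_ (m+[n∸m]≡n x≤t) (m+[n∸m]≡n y≤t) ⟨
    (x + (t ∸ x)) + (y + (t ∸ y)) ≡⟨ rearrange x (t ∸ x) y (t ∸ y) ⟩
    (x + y) + ((t ∸ x) + (t ∸ y)) ≡⟨ cong₂ _+_ x+y≡M t∸x+t∸y≡M ⟩
    M + M                         ∎)) t≢M
    where
    open ≡-Reasoning
    rearrange : ∀ a b c d → (a + b) + (c + d) ≡ (a + c) + (b + d)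
    rearrange = solve-∀

  splits-compl : ∀ {q t t′ x} → IsGVertex m q → t + t′ ≡ M + M → Splits q t x → Splits q t′ (M ∸ x)
  splits-compl {q} {t} {t′} {x} q-vtx t+t′≡2M (x∈q , x≤t , y∈πq) =
    InV-compl q-vtx x∈q , M∸x≤t′ ,
    subst (λ z → InV m z (partner q)) (sym t′∸[M∸x]≡M∸y) (InV-compl (partner-vertex q-vtx) y∈πq)
    where
    y = t ∸ x
    M∸x+M∸y≡t′ : (M ∸ x) + (M ∸ y) ≡ t′
    M∸x+M∸y≡t′ = +-cancelˡ-≡ t _ _ (begin
      t + ((M ∸ x) + (M ∸ y))       ≡⟨ cong (_+ ((M ∸ x) + (M ∸ y))) (m+[n∸m]≡n x≤t) ⟨
      (x + y) + ((M ∸ x) + (M ∸ y)) ≡⟨ rearrange x y (M ∸ x) (M ∸ y) ⟩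
      (x + (M ∸ x)) + (y + (M ∸ y)) ≡⟨ cong₂ _+_ (m+[n∸m]≡n (InV≤M q-vtx x∈q))
                                                 (m+[n∸m]≡n (InV≤M (partner-vertex q-vtx) y∈πq)) ⟩
      M + M                         ≡⟨ t+t′≡2M ⟨
      t + t′                        ∎)
      where
      open ≡-Reasoning
      rearrange : ∀ a b c d → (a + b) + (c + d) ≡ (a + c) + (b + d)
      rearrange = solve-∀
    M∸x≤t′ : M ∸ x ≤ t′
    M∸x≤t′ = subst (M ∸ x ≤_) M∸x+M∸y≡t′ (m≤m+n (M ∸ x) (M ∸ y))
    t′∸[M∸x]≡M∸y : t′ ∸ (M ∸ x) ≡ M ∸ y
    t′∸[M∸x]≡M∸y = sym (m+n≡o⇒n≡o∸m M∸x+M∸y≡t′)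

  splits⇒≤M+M : ∀ {q t x} → IsGVertex m q → Splits q t x → t ≤ M + M
  splits⇒≤M+M {q} {t} {x} q-vtx (x∈q , x≤t , y∈πq) =
    subst (_≤ M + M) (m+[n∸m]≡n x≤t) (+-mono-≤ (InV≤M q-vtx x∈q) (InV≤M (partner-vertex q-vtx) y∈πq))

  -- a, or 2M − a after replacing both labels of an edge of G(a) by their complements
  Target : ℕ → Set
  Target t = t ≡ a ⊎ t + a ≡ M + M

  splits-a : ∀ {q} → IsGVertex m q → ∃[ x ] Splits q a x
  splits-a {q} q-vtx with K-adj q (partner q) (K-partner q-vtx)
  ... | _ , _ , _ , z₁ , z₂ , z₁∈q , z₂∈πq , z₁+z₂≡a =
    z₁ , z₁∈q , subst (z₁ ≤_) z₁+z₂≡a (m≤m+n z₁ z₂) ,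
    subst (λ z → InV m z (partner q)) (m+n≡o⇒n≡o∸m z₁+z₂≡a) z₂∈πq

  a≤M+M : ∀ {q} → IsGVertex m q → a ≤ M + M
  a≤M+M q-vtx = splits⇒≤M+M q-vtx (proj₂ (splits-a q-vtx))

  splits-target : ∀ {q t} → IsGVertex m q → Target t → ∃[ x ] Splits q t x
  splits-target q-vtx (inj₁ refl) = splits-a q-vtx
  splits-target {t = t} q-vtx (inj₂ t+a≡2M) with splits-a q-vtx
  ... | x , x-splits = M ∸ x , splits-compl q-vtx (trans (+-comm a t) t+a≡2M) x-splits

  GAdj⇒a≢M : ∀ {q p} → GAdj m a q p → a ≢ M
  GAdj⇒a≢M {q} {p} (q-vtx , p-vtx , q≢p , z₁ , z₂ , z₁∈q , z₂∈p , z₁+z₂≡a) a≡M = q≢p (begin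
    q                 ≡⟨ vertexOf-unique q-vtx (InV-compl q-vtx z₁∈q) ⟨
    vertexOf (M ∸ z₁) ≡⟨ cong vertexOf (m+n≡o⇒n≡o∸m {z₁} {z₂} (trans z₁+z₂≡a a≡M)) ⟨
    vertexOf z₂       ≡⟨ vertexOf-unique p-vtx z₂∈p ⟩
    p                 ∎)
    where open ≡-Reasoning

  Target≢M : ∀ {q t} → IsGVertex m q → Target t → t ≢ M
  Target≢M q-vtx (inj₁ refl) = GAdj⇒a≢M (K-adj _ _ (K-partner q-vtx))
  Target≢M {t = t} q-vtx (inj₂ t+a≡2M) t≡M = GAdj⇒a≢M (K-adj _ _ (K-partner q-vtx))
    (+-cancelˡ-≡ M a M (trans (cong (_+ a) (sym t≡M)) t+a≡2M))

  Target-compl : ∀ {t t′} → Target t → t + t′ ≡ M + M → Target t′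
  Target-compl (inj₁ refl) a+t′≡2M = inj₂ (trans (+-comm _ a) a+t′≡2M)
  Target-compl {t} {t′} (inj₂ t+a≡2M) t+t′≡2M = inj₁ (+-cancelˡ-≡ t t′ a (trans t+t′≡2M (sym t+a≡2M)))

  Target-cases : ∀ {t t′} → Target t → Target t′ → t ≡ t′ ⊎ t + t′ ≡ M + M
  Target-cases (inj₁ refl) (inj₁ refl) = inj₁ refl
  Target-cases (inj₁ refl) (inj₂ t′+a≡2M) = inj₂ (trans (+-comm a _) t′+a≡2M)
  Target-cases (inj₂ t+a≡2M) (inj₁ refl) = inj₂ t+a≡2M
  Target-cases {t} {t′} (inj₂ t+a≡2M) (inj₂ t′+a≡2M) = inj₁ (+-cancelʳ-≡ a t t′ (trans t+a≡2M (sym t′+a≡2M)))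

module Construction (k : ℕ) {a : ℕ} {K : ℕ → ℕ → Set} (matching : IsPerfectMatching (suc (2 * k)) a K) where

  private
    m : ℕ
    m = suc (2 * k)

  open ComplementPairs m
  open Partners m a matching
  open Splitting m a matching
  open GoodForms k

  one-vertex : IsGVertex m 1
  one-vertex = s≤s z≤n , s≤s z≤n

  record RowSums : Set where
    field
      even odd : ℕ
      even+odd : even + odd ≡ M + M
      even-target : Target even
      one-splits : Splits 1 even 1

  -- The first row starts with the label 1, so its pair sum is whichever of a and 2M − a the vertex 1 splits.
  rowSums : RowSums
  rowSums with splits-a one-vertex | a≤M+M one-vertex
  ... | x , x-splits@(inj₁ refl , _) | a≤2M = record
    { even = a ; odd = (M + M) ∸ a ; even+odd = m+[n∸m]≡n a≤2M ; even-target = inj₁ refl ; one-splits = x-splits }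
  ... | x , x-splits@(inj₂ refl , _) | a≤2M = record
    { even = (M + M) ∸ a ; odd = a ; even+odd = m∸n+n≡m a≤2M ; even-target = inj₂ (m∸n+n≡m a≤2M)
    ; one-splits = subst (Splits 1 ((M + M) ∸ a)) (m∸[m∸n]≡n (vertex≤M one-vertex))
                         (splits-compl one-vertex (m+[n∸m]≡n a≤2M) x-splits) }

  open RowSums rowSums public

  even-unique : ∀ {t} → Target t → Splits 1 t 1 → t ≡ even
  even-unique t-target one-splits-t with Target-cases t-target even-target
  ... | inj₁ t≡even = t≡even
  ... | inj₂ t+even≡2M = contradiction
    (trans (cong (1 +_) (splits-unique one-vertex (Target≢M one-vertex t-target) one-splits-t
                          (splits-compl one-vertex (trans (+-comm even _) t+even≡2M) one-splits)))
           (m+[n∸m]≡n (vertex≤M one-vertex)))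
    (x+x≢M 1)

  alternate-target : ∀ i → Target (alternate even odd i)
  alternate-target i = go even odd i even-target (Target-compl even-target even+odd)
    where
    go : ∀ x y i → Target x → Target y → Target (alternate x y i)
    go x y zero x-target _ = x-target
    go x y (suc i) x-target y-target = go y x i y-target x-target

  rowTarget : Fin m → ℕ
  rowTarget r = alternate even odd (toℕ r)

  rowLabel : ℕ → ℕ → Fin 4 → ℕ
  rowLabel x t c0 = x
  rowLabel x t c1 = t ∸ x
  rowLabel x t c2 = M ∸ (t ∸ x)
  rowLabel x t c3 = M ∸ x

  label : Vec ℕ (2 * k) → Labeling m
  label qs (r , c) = rowLabel (solve (lookupᵥ (1 ∷ qs) r) (rowTarget r)) (rowTarget r) c

  label-origin : ∀ qs → label qs (zero , c0) ≡ 1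
  label-origin qs = splits-unique one-vertex (Target≢M one-vertex even-target) (solve-correct one-splits) one-splits

  -- columns 1 and 4 hold labels of the row vertex, columns 2 and 3 labels of its partner
  side : Fin 4 → Bool
  side c0 = true
  side c1 = false
  side c2 = false
  side c3 = true

  endpoint : Bool → ℕ → ℕ
  endpoint true q = q
  endpoint false q = partner q

  module LabelOfChain (qs : Vec ℕ (2 * k)) (chain : Chain vertices (1 ∷ qs)) where

    open Enumerates (chain⇒enumerates ∈-vertices⁻ chain)

    u : Fin m → ℕ
    u = lookupᵥ (1 ∷ qs)

    u-vertex : ∀ r → IsGVertex m (u r)
    u-vertex r = ∈-vertices⁻ (members r)

    endpoint-vertex : ∀ b r → IsGVertex m (endpoint b (u r))
    endpoint-vertex true r = u-vertex r
    endpoint-vertex false r = partner-vertex (u-vertex r)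

    column₀-splits : ∀ r → Splits (u r) (rowTarget r) (label qs (r , c0))
    column₀-splits r = solve-correct (proj₂ (splits-target (u-vertex r) (alternate-target (toℕ r))))

    label-InV : ∀ r c → InV m (label qs (r , c)) (endpoint (side c) (u r))
    label-InV r c0 = proj₁ (column₀-splits r)
    label-InV r c1 = proj₂ (proj₂ (column₀-splits r))
    label-InV r c2 = InV-compl (endpoint-vertex false r) (label-InV r c1)
    label-InV r c3 = InV-compl (u-vertex r) (label-InV r c0)

    label≤M : ∀ r c → label qs (r , c) ≤ M
    label≤M r c = InV≤M (endpoint-vertex (side c) r) (label-InV r c)

    vertexOf-label-endpoint : ∀ r c → vertexOf (label qs (r , c)) ≡ endpoint (side c) (u r)
    vertexOf-label-endpoint r c = vertexOf-unique (endpoint-vertex (side c) r) (label-InV r c)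

    endpoint-separated : ∀ b b′ r r′ → endpoint b (u r) ≡ endpoint b′ (u r′) → r ≡ r′ × b ≡ b′
    endpoint-separated true true r r′ eq = separated r r′ (inj₁ eq) , refl
    endpoint-separated true false r r′ eq with separated r r′ (inj₂ eq)
    ... | refl = contradiction (sym eq) (partner-fixpoint-free (u-vertex r))
    endpoint-separated false true r r′ eq with separated r′ r (inj₂ (sym eq))
    ... | refl = contradiction eq (partner-fixpoint-free (u-vertex r))
    endpoint-separated false false r r′ eq =
      separated r r′ (inj₁ (trans (sym (partner-involutive (u-vertex r)))
                                  (trans (cong partner eq) (partner-involutive (u-vertex r′))))) , refl

    column-injective : ∀ r c c′ → side c ≡ side c′ → label qs (r , c) ≡ label qs (r , c′) → c ≡ c′
    column-injective r c0 c0 _ _ = refl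
    column-injective r c0 c3 _ eq = contradiction eq (x≢M∸x (label≤M r c0))
    column-injective r c3 c0 _ eq = contradiction (sym eq) (x≢M∸x (label≤M r c0))
    column-injective r c3 c3 _ _ = refl
    column-injective r c1 c1 _ _ = refl
    column-injective r c1 c2 _ eq = contradiction eq (x≢M∸x (label≤M r c1))
    column-injective r c2 c1 _ eq = contradiction (sym eq) (x≢M∸x (label≤M r c1))
    column-injective r c2 c2 _ _ = refl
    column-injective r c0 c1 () _
    column-injective r c0 c2 () _
    column-injective r c1 c0 () _
    column-injective r c1 c3 () _
    column-injective r c2 c0 () _
    column-injective r c2 c3 () _
    column-injective r c3 c1 () _
    column-injective r c3 c2 () _

    label-bijective : IsBijectiveLabeling m (label qs)
    label-bijective = bounds , injective , onto
      where
      bounds : ∀ v → 1 ≤ label qs v × label qs v ≤ 4 * m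
      bounds (r , c) = InV-bounds (endpoint-vertex (side c) r) (label-InV r c)
      injective : ∀ v w → label qs v ≡ label qs w → v ≡ w
      injective (r , c) (r′ , c′) eq = same-row (proj₁ rows-sides) (proj₂ rows-sides) eq
        where
        rows-sides = endpoint-separated (side c) (side c′) r r′
          (trans (sym (vertexOf-label-endpoint r c)) (trans (cong vertexOf eq) (vertexOf-label-endpoint r′ c′)))
        same-row : r ≡ r′ → side c ≡ side c′ → label qs (r , c) ≡ label qs (r′ , c′) → (r , c) ≡ (r′ , c′)
        same-row refl same-side eq = cong (r ,_) (column-injective r c c′ same-side eq)
      onto : ∀ y → 1 ≤ y → y ≤ 4 * m → ∃[ v ] label qs v ≡ y
      onto y 1≤y y≤4m = from-cover (covers (∈-vertices⁺ (proj₂ vertexOf-y)))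
        where
        vertexOf-y = vertexOf-correct 1≤y y≤4m
        in-row : ∀ r c c′ → label qs (r , c′) ≡ M ∸ label qs (r , c) →
                 y ≡ label qs (r , c) ⊎ y + label qs (r , c) ≡ M → ∃[ v ] label qs v ≡ y
        in-row r c c′ _ (inj₁ y≡x) = (r , c) , sym y≡x
        in-row r c c′ x′≡M∸x (inj₂ y+x≡M) =
          (r , c′) , trans x′≡M∸x (sym (m+n≡o⇒n≡o∸m (trans (+-comm (label qs (r , c)) y) y+x≡M)))
        from-cover : ∃[ r ] (vertexOf y ≡ u r ⊎ vertexOf y ≡ partner (u r)) → ∃[ v ] label qs v ≡ y
        from-cover (r , inj₁ vertexOf≡u) =
          in-row r c0 c3 refl (InV-cases (u-vertex r) (subst (InV m y) vertexOf≡u (proj₁ vertexOf-y)) (label-InV r c0))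
        from-cover (r , inj₂ vertexOf≡πu) =
          in-row r c1 c2 refl (InV-cases (endpoint-vertex false r) (subst (InV m y) vertexOf≡πu (proj₁ vertexOf-y)) (label-InV r c1))

    label-GoodForm : GoodForm K (label qs)
    label-GoodForm = record
      { bijective = label-bijective
      ; compl₀₃ = λ r → m+[n∸m]≡n (label≤M r c0)
      ; compl₁₂ = λ r → m+[n∸m]≡n (label≤M r c1)
      ; evenSum+oddSum = even+odd
      ; pairSum = λ r → m+[n∸m]≡n (proj₁ (proj₂ (column₀-splits r)))
      ; matched = λ r → subst₂ K (sym (vertexOf-label-endpoint r c0)) (sym (vertexOf-label-endpoint r c1))
                                 (K-partner (u-vertex r)) }

  label-injective : ∀ {qs qs′} → Chain vertices (1 ∷ qs) → Chain vertices (1 ∷ qs′) → label qs ≗ label qs′ → qs ≡ qs′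
  label-injective {qs} {qs′} chain chain′ same = ∷-injectiveʳ (begin
    1 ∷ qs                          ≡⟨ tabulate∘lookup (1 ∷ qs) ⟨
    tabulate (lookupᵥ (1 ∷ qs))     ≡⟨ tabulate-cong u≗u′ ⟩
    tabulate (lookupᵥ (1 ∷ qs′))    ≡⟨ tabulate∘lookup (1 ∷ qs′) ⟩
    1 ∷ qs′                         ∎)
    where
    open ≡-Reasoning
    u≗u′ : lookupᵥ (1 ∷ qs) ≗ lookupᵥ (1 ∷ qs′)
    u≗u′ r = trans (sym (LabelOfChain.vertexOf-label-endpoint qs chain r c0))
               (trans (cong vertexOf (same (r , c0))) (LabelOfChain.vertexOf-label-endpoint qs′ chain′ r c0))

-- The listing of a labeling

module FirstRowSum (k : ℕ) {a : ℕ} {K : ℕ → ℕ → Set} (matching : IsPerfectMatching (suc (2 * suc k)) a K)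
  {X : Labeling (suc (2 * suc k))} (form : GoodForms.GoodForm (suc k) K X) where

  private
    m : ℕ
    m = suc (2 * suc k)
    K-adj = proj₁ matching

  open ComplementPairs m
  open Splitting m a matching
  open GoodForms (suc k)

  open GoodForm form

  -- The K-edge of a row joins labels from columns {1,4} and {2,3}; the four choices give these sums.
  edge-target : ∀ r → Target (X (r , c0) + X (r , c1)) ⊎ Target (X (r , c0) + X (r , c2))
  edge-target r with K-adj _ _ (matched r)
  ... | q-vtx , p-vtx , _ , z₁ , z₂ , z₁∈q , z₂∈p , z₁+z₂≡a
    with InV-pair-cases q-vtx z₁∈q (proj₁ (vertexOf-label bijective (r , c0))) (compl₀₃ r)
       | InV-pair-cases p-vtx z₂∈p (proj₁ (vertexOf-label bijective (r , c1))) (compl₁₂ r)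
  ... | inj₁ refl | inj₁ refl = inj₁ (inj₁ z₁+z₂≡a)
  ... | inj₁ refl | inj₂ refl = inj₂ (inj₁ z₁+z₂≡a)
  ... | inj₂ refl | inj₁ refl = inj₂ (inj₂ (trans (cong ((X (r , c0) + X (r , c2)) +_) (sym z₁+z₂≡a))
                                            (trans (rearrange (X (r , c0)) (X (r , c1)) (X (r , c2)) (X (r , c3)))
                                                   (cong₂ _+_ (compl₀₃ r) (compl₁₂ r)))))
    where
    rearrange : ∀ a b c d → (a + c) + (d + b) ≡ (a + d) + (b + c)
    rearrange = solve-∀
  ... | inj₂ refl | inj₂ refl = inj₁ (inj₂ (trans (cong ((X (r , c0) + X (r , c1)) +_) (sym z₁+z₂≡a))
                                            (trans (rearrange (X (r , c0)) (X (r , c1)) (X (r , c2)) (X (r , c3)))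
                                                   (cong₂ _+_ (compl₀₃ r) (compl₁₂ r)))))
    where
    rearrange : ∀ a b c d → (a + b) + (d + c) ≡ (a + d) + (b + c)
    rearrange = solve-∀

  private
    c0≢c3 : _≢_ {A = Fin 4} c0 c3
    c0≢c3 ()
    c1≢c3 : _≢_ {A = Fin 4} c1 c3
    c1≢c3 ()

    complement-position : ∀ r v → X v + X (r , c0) ≡ M → v ≡ (r , c3)
    complement-position r v v+x≡M = proj₁ (proj₂ bijective) v (r , c3)
      (+-cancelʳ-≡ (X (r , c0)) _ _ (trans v+x≡M (trans (sym (compl₀₃ r)) (+-comm (X (r , c0)) (X (r , c3))))))

  -- Equal or complementary cross sums in consecutive rows would put the complement of X (r , c0),
  -- that is X (r , c3), into row r + 1.
  cross-sums-differ : ∀ (r : Fin (2 * suc k)) → X (inject₁ r , c0) + X (inject₁ r , c2) ≢ X (suc r , c0) + X (suc r , c2)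
  cross-sums-differ r eq = c1≢c3 (cong proj₂ (complement-position (inject₁ r) (suc r , c1)
    (trans (+-comm (X (suc r , c1)) (X (inject₁ r , c0))) (x+x≡y+y⇒x≡y (+-cancel-by
      (identity (X (inject₁ r , c0)) (X (inject₁ r , c1)) (X (inject₁ r , c2)) (X (suc r , c0)) (X (suc r , c1)) (X (suc r , c2)) M)
      (cong₂ _+_ (cong₂ _+_ (cong₂ _+_ (sym eq) (compl₁₂ (inject₁ r))) (sym (compl₁₂ (suc r))))
                 (sym (pairSum-consecutive form r))))))))
    where
    identity : ∀ x₀ x₁ x₂ y₀ y₁ y₂ M →
      ((x₀ + y₁) + (x₀ + y₁)) + ((y₀ + y₂) + (x₁ + x₂) + M + (M + M)) ≡
      (M + M) + ((x₀ + x₂) + M + (y₁ + y₂) + ((x₀ + x₁) + (y₀ + y₁)))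
    identity = solve-∀

  cross-sums-not-complementary : ∀ (r : Fin (2 * suc k)) →
    (X (inject₁ r , c0) + X (inject₁ r , c2)) + (X (suc r , c0) + X (suc r , c2)) ≢ M + M
  cross-sums-not-complementary r eq = c0≢c3 (cong proj₂ (complement-position (inject₁ r) (suc r , c0)
    (trans (+-comm (X (suc r , c0)) (X (inject₁ r , c0))) (x+x≡y+y⇒x≡y (+-cancel-by
      (identity (X (inject₁ r , c0)) (X (inject₁ r , c1)) (X (inject₁ r , c2)) (X (suc r , c0)) (X (suc r , c1)) (X (suc r , c2)) M)
      (cong₂ _+_ (trans (cong₂ _+_ (compl₁₂ (inject₁ r)) (compl₁₂ (suc r))) (sym eq))
                 (sym (pairSum-consecutive form r))))))))
    where
    identity : ∀ x₀ x₁ x₂ y₀ y₁ y₂ M →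
      ((x₀ + y₀) + (x₀ + y₀)) + (((x₁ + x₂) + (y₁ + y₂)) + (M + M)) ≡
      (M + M) + (((x₀ + x₂) + (y₀ + y₂)) + ((x₀ + x₁) + (y₀ + y₁)))
    identity = solve-∀

  first-pairSum-target : Target (X (zero , c0) + X (zero , c1))
  first-pairSum-target with edge-target zero
  ... | inj₁ target₀ = target₀
  ... | inj₂ cross₀ with edge-target (suc zero)
  ...   | inj₁ target₁ =
    Target-compl target₁ (trans (+-comm (X (suc zero , c0) + X (suc zero , c1)) _) (pairSum-consecutive form zero))
  ...   | inj₂ cross₁ with Target-cases cross₀ cross₁
  ...     | inj₁ eq = contradiction eq (cross-sums-differ zero)
  ...     | inj₂ eq = contradiction eq (cross-sums-not-complementary zero)

module Reconstruction (k : ℕ) {a : ℕ} {K : ℕ → ℕ → Set} (matching : IsPerfectMatching (suc (2 * suc k)) a K)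
  {X : Labeling (suc (2 * suc k))} (form : GoodForms.GoodForm (suc k) K X) (origin-one : X (zero , c0) ≡ 1) where

  private
    m : ℕ
    m = suc (2 * suc k)

  open ComplementPairs m
  open Partners m a matching
  open Splitting m a matching
  open Construction (suc k) matching
  open GoodForms (suc k)

  open GoodForm form
  open FirstRowSum k matching form

  u : Fin m → ℕ
  u r = vertexOf (X (r , c0))

  private
    u-vertex : ∀ r → IsGVertex m (u r)
    u-vertex r = proj₂ (vertexOf-label bijective (r , c0))

    vertexOf₁≡partner : ∀ r → vertexOf (X (r , c1)) ≡ partner (u r)
    vertexOf₁≡partner r = partner-unique (matched r)

    row-splits : ∀ r → Splits (u r) (X (r , c0) + X (r , c1)) (X (r , c0))
    row-splits r = proj₁ (vertexOf-label bijective (r , c0)) , m≤m+n _ _ ,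
      subst₂ (InV m) (sym (m+n∸m≡n (X (r , c0)) _)) (vertexOf₁≡partner r) (proj₁ (vertexOf-label bijective (r , c1)))

    u-origin : u zero ≡ 1
    u-origin = trans (cong vertexOf origin-one) (vertexOf-unique one-vertex (inj₁ refl))

  evenSum≡even : evenSum ≡ even
  evenSum≡even = trans (sym (pairSum zero))
    (even-unique first-pairSum-target
      (subst₂ (λ q x → Splits q (X (zero , c0) + X (zero , c1)) x) u-origin origin-one (row-splits zero)))

  oddSum≡odd : oddSum ≡ odd
  oddSum≡odd = +-cancelˡ-≡ even oddSum odd (trans (cong (_+ oddSum) (sym evenSum≡even)) (trans evenSum+oddSum (sym even+odd)))

  pairSum≡rowTarget : ∀ r → X (r , c0) + X (r , c1) ≡ rowTarget r
  pairSum≡rowTarget r = trans (pairSum r) (cong₂ (λ x y → alternate x y (toℕ r)) evenSum≡even oddSum≡odd)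

  qs : Vec ℕ (2 * suc k)
  qs = tabulate (u ∘ suc)

  lookup-qs : ∀ r → lookupᵥ (1 ∷ qs) r ≡ u r
  lookup-qs zero = sym u-origin
  lookup-qs (suc r) = lookup∘tabulate (u ∘ suc) r

  private
    injective = proj₁ (proj₂ bijective)

    u-separated : ∀ r r′ → u r ≡ u r′ ⊎ u r ≡ partner (u r′) → r ≡ r′
    u-separated r r′ (inj₁ u≡u′)
      with InV-pair-cases (u-vertex r′) (subst (InV m (X (r , c0))) u≡u′ (proj₁ (vertexOf-label bijective (r , c0))))
                        (proj₁ (vertexOf-label bijective (r′ , c0))) (compl₀₃ r′)
    ... | inj₁ x≡x′ = cong proj₁ (injective _ _ x≡x′)
    ... | inj₂ x≡x₃′ = contradiction (cong proj₂ (injective _ _ x≡x₃′)) (λ ())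
    u-separated r r′ (inj₂ u≡πu′)
      with InV-pair-cases (proj₂ (vertexOf-label bijective (r′ , c1)))
                        (subst (InV m (X (r , c0))) (trans u≡πu′ (sym (vertexOf₁≡partner r′)))
                               (proj₁ (vertexOf-label bijective (r , c0))))
                        (proj₁ (vertexOf-label bijective (r′ , c1))) (compl₁₂ r′)
    ... | inj₁ x≡x₁′ = contradiction (cong proj₂ (injective _ _ x≡x₁′)) (λ ())
    ... | inj₂ x≡x₂′ = contradiction (cong proj₂ (injective _ _ x≡x₂′)) (λ ())

    u-covers : ∀ {y} → IsGVertex m y → ∃[ r ] (y ≡ u r ⊎ y ≡ partner (u r))
    u-covers y-vtx = let (r , y≡) = vertex-in-row form y-vtx in r , Sum.map₂ (λ y≡ → trans y≡ (vertexOf₁≡partner r)) y≡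

  enumerates : Enumerates vertices (1 ∷ qs)
  enumerates = record
    { members = λ r → subst (_∈ vertices) (sym (lookup-qs r)) (∈-vertices⁺ (u-vertex r))
    ; separated = λ r r′ → u-separated r r′ ∘ Sum.map (λ eq → trans (sym (lookup-qs r)) (trans eq (lookup-qs r′)))
                                                        (λ eq → trans (sym (lookup-qs r)) (trans eq (cong partner (lookup-qs r′))))
    ; covers = λ y∈ → let (r , y≡) = u-covers (∈-vertices⁻ y∈) in
        r , Sum.map (λ eq → trans eq (sym (lookup-qs r))) (λ eq → trans eq (cong partner (sym (lookup-qs r)))) y≡ }

  chain : Chain vertices (1 ∷ qs)
  chain = enumerates⇒chain (1 ∷ qs) enumerates

  private
    column₀ : ∀ r → X (r , c0) ≡ label qs (r , c0)
    column₀ r = splits-unique (subst (IsGVertex m) (sym (lookup-qs r)) (u-vertex r))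
      (Target≢M one-vertex (alternate-target (toℕ r))) splits (solve-correct splits)
      where
      splits : Splits (lookupᵥ (1 ∷ qs) r) (rowTarget r) (X (r , c0))
      splits = subst₂ (λ q t → Splits q t (X (r , c0))) (sym (lookup-qs r)) (pairSum≡rowTarget r) (row-splits r)

    column₁ : ∀ r → X (r , c1) ≡ label qs (r , c1)
    column₁ r = trans (m+n≡o⇒n≡o∸m (pairSum≡rowTarget r)) (cong (rowTarget r ∸_) (column₀ r))

  X≗label : X ≗ label qs
  X≗label (r , c0) = column₀ r
  X≗label (r , c1) = column₁ r
  X≗label (r , c2) = trans (m+n≡o⇒n≡o∸m (compl₁₂ r)) (cong (M ∸_) (column₁ r))
  X≗label (r , c3) = trans (m+n≡o⇒n≡o∸m (compl₀₃ r)) (cong (M ∸_) (column₀ r))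

module Classification (k : ℕ) {a : ℕ} {K : ℕ → ℕ → Set} (matching : IsPerfectMatching (suc (2 * suc k)) a K) where

  private
    m : ℕ
    m = suc (2 * suc k)

  open Partners m a matching
  open Construction (suc k) matching
  open GoodForms (suc k)

  remaining : Pool (2 * suc k) (removePair 1 vertices)
  remaining = Pool-removePair vertices-pool (∈-vertices⁺ one-vertex)

  labeling : Fin (2 ^ (2 * suc k) * (2 * suc k) !) → Labeling m
  labeling i = label (decode remaining i)

  chain : ∀ i → Chain vertices (1 ∷ decode remaining i)
  chain i = ∈-vertices⁺ one-vertex , decode-chain remaining i

  labeling-good : ∀ i → Good m K (labeling i)
  labeling-good i = GoodForm⇒Good (suc k) matching (LabelOfChain.label-GoodForm _ (chain i))

  labeling-inequivalent : ∀ i j → i ≢ j → ¬ KBEquivalent (labeling i) (labeling j)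
  labeling-inequivalent i j i≢j (w , j≗i∘w) = i≢j (decode-injective remaining (label-injective (chain i) (chain j) i≗j))
    where
    w-fixes-origin : act w origin ≡ origin
    w-fixes-origin = proj₁ (proj₂ (LabelOfChain.label-bijective _ (chain i))) _ _
      (trans (sym (j≗i∘w origin)) (trans (label-origin (decode remaining j)) (sym (label-origin (decode remaining i)))))
    i≗j : labeling i ≗ labeling j
    i≗j v = begin
      labeling i v         ≡⟨ cong (labeling i) (act-fixing-origin w w-fixes-origin v) ⟨
      labeling i (act w v) ≡⟨ j≗i∘w v ⟨
      labeling j v         ∎
      where open ≡-Reasoning

  -- Moving the label 1 to the origin puts X in the image of label; the inverse move is the equivalence.
  labeling-complete : ∀ X → Good m K X → ∃[ i ] KBEquivalent (labeling i) X
  labeling-complete X good = i , map ginv (path v) , λ v′ → begin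
    X v′                                          ≡⟨ cong X (act∘act-inverse≗id (path v) v′) ⟨
    X (act (path v) (act (map ginv (path v)) v′)) ≡⟨ moved≗label _ ⟩
    label qs (act (map ginv (path v)) v′)         ≡⟨ cong (λ qs′ → label qs′ (act (map ginv (path v)) v′)) decode≡qs ⟨
    labeling i (act (map ginv (path v)) v′)       ∎
    where
    open ≡-Reasoning
    form = Good⇒GoodForm (suc k) good
    one-labelled = proj₂ (proj₂ (GoodForm.bijective form)) 1 (s≤s z≤n) (s≤s z≤n)
    v = proj₁ one-labelled
    moved-form = GoodForm-∘act (proj₁ (proj₂ matching)) (path v) (path-avoids-Uinv v) form
    moved-origin : X (act (path v) origin) ≡ 1
    moved-origin = trans (cong X (act-path v)) (proj₂ one-labelled)
    open Reconstruction k matching moved-form moved-origin using (qs) renaming (chain to moved-chain; X≗label to moved≗label)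
    i = proj₁ (decode-complete remaining qs (proj₂ moved-chain))
    decode≡qs = proj₂ (decode-complete remaining qs (proj₂ moved-chain))

corollary5p1 : (m a : ℕ) → (∃[ k ] m ≡ suc (2 * k)) → 3 ≤ m → 1 ≤ a →
    (K : ℕ → ℕ → Set) → IsPerfectMatching m a K →
    ExactlyNClasses m (2 ^ (m ∸ 1) * (m ∸ 1) !) (Good m K)
corollary5p1 .(suc (2 * zero)) a (zero , refl) (s≤s ()) _ K matching
corollary5p1 .(suc (2 * suc k)) a (suc k , refl) _ _ K matching =
  labeling , labeling-good , labeling-inequivalent , labeling-complete
  where open Classification k matching
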